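{- For every rook $r\in R_n$ there is a unique element $\pi_r\in R_n^0$ such that $1_n\cdot\pi_r=r$. Moreover, for all $r,s\in R_n$, $\pi_r\pi_s=\pi_{r\cdot\pi_s}$; that is, under the identification $r\leftrightarrow\pi_r$ the right action of $R_n^0$ on $R_n$ is the right multiplication of $R_n^0$.
   Context: A rook of size $n$ is a word $r=r_1\dots r_n$ over $\{0,\dots,n\}$ whose nonzero letters are pairwise distinct; $R_n$ is the set of these and $1_n=12\cdots n$. The $0$-rook monoid $R_n^0$ is the monoid presented by generators $\pi_0,\dots,\pi_{n-1}$ and relations $\pi_i^2=\pi_i$ ($0\le i\le n-1$), $\pi_i\pi_{i+1}\pi_i=\pi_{i+1}\pi_i\pi_{i+1}$ ($1\le i\le n-2$), $\pi_1\pi_0\pi_1\pi_0=\pi_0\pi_1\pi_0=\pi_0\pi_1\pi_0\pi_1$, $\pi_i\pi_j=\pi_j\pi_i$ ($0\le i,j\le n-1$, $|i-j|\ge2$). It acts on the right on $R_n$ by $r\cdot\pi_0=0\,r_2\cdots r_n$ and, for $1\le k\le n-1$, $r\cdot\pi_k$ equals $r$ with $r_k$ and $r_{k+1}$ exchanged if $r_k<r_{k+1}$, and equals $r$ otherwise (these maps satisfy the defining relations, so this is a monoid action). -}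

module Defs where

open import Data.Nat using (ℕ; zero; suc; _+_; _≤_)
open import Data.Fin as F using (Fin; toℕ; inject₁)
open import Data.Fin.Properties using (_<?_)
open import Data.Vec using (Vec; lookup; tabulate; _[_]≔_)
open import Data.List using (List; []; _∷_; _++_)
open import Data.Sum using (_⊎_)
open import Data.Product using (Σ)
open import Relation.Binary.PropositionalEquality using (_≡_)
open import Relation.Nullary using (does)
open import Data.Bool using (if_then_else_)

-- Words of length n over the letters {0,…,n}; letter k is encoded by Fin (suc n)
-- with toℕ = k (so 0 is F.zero).
Word : ℕ → Set
Word n = Vec (Fin (suc n)) n

IsRook : {n : ℕ} → Word n → Set
IsRook {n} r = (i j : Fin n) → lookup r i ≡ lookup r j → (lookup r i ≡ F.zero) ⊎ (i ≡ j)

Rook : ℕ → Set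
Rook n = Σ (Word n) IsRook

one : (n : ℕ) → Word n
one n = tabulate F.suc

-- Generators π_0,…,π_{n-1} of R_n^0: generator π_k is encoded by k : Fin n.
-- Words in the generators (elements of the free monoid).
GWord : ℕ → Set
GWord n = List (Fin n)

swapIfLess : {n : ℕ} → Word n → Fin n → Fin n → Word n
swapIfLess r i j =
  if does (lookup r i <? lookup r j)
  then (r [ i ]≔ lookup r j) [ j ]≔ lookup r i
  else r

-- Action of a single generator.  Positions are 0-indexed here:
-- π_0 sets position 0 (= r_1) to 0; π_{k+1} acts on positions k, k+1
-- (= r_{k+1}, r_{k+2} in the paper's 1-indexed notation).
actGen : {n : ℕ} → Word n → Fin n → Word n
actGen {suc m} r F.zero    = r [ F.zero ]≔ F.zero
actGen {suc m} r (F.suc k) = swapIfLess r (inject₁ k) (F.suc k)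

_·_ : {n : ℕ} → Word n → GWord n → Word n
r · []      = r
r · (g ∷ w) = actGen r g · w

infixl 5 _·_

-- The congruence on generator words generated by the defining relations of R_n^0.
-- R_n^0 is the quotient GWord n / _≈_ ; equality in R_n^0 is _≈_.
data _≈_ {n : ℕ} : GWord n → GWord n → Set where
  ≈-refl  : ∀ {u} → u ≈ u
  ≈-sym   : ∀ {u v} → u ≈ v → v ≈ u
  ≈-trans : ∀ {u v w} → u ≈ v → v ≈ w → u ≈ w
  ≈-cong  : ∀ {u u' v v'} → u ≈ u' → v ≈ v' → (u ++ v) ≈ (u' ++ v')
  idem    : ∀ (i : Fin n) → (i ∷ i ∷ []) ≈ (i ∷ [])
  braid   : ∀ (i j : Fin n) → 1 ≤ toℕ i → toℕ j ≡ suc (toℕ i) →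
            (i ∷ j ∷ i ∷ []) ≈ (j ∷ i ∷ j ∷ [])
  rookL   : ∀ (z o : Fin n) → toℕ z ≡ 0 → toℕ o ≡ 1 →
            (o ∷ z ∷ o ∷ z ∷ []) ≈ (z ∷ o ∷ z ∷ [])
  rookR   : ∀ (z o : Fin n) → toℕ z ≡ 0 → toℕ o ≡ 1 →
            (z ∷ o ∷ z ∷ []) ≈ (z ∷ o ∷ z ∷ o ∷ [])
  -- π_i π_j = π_j π_i  (|i - j| ≥ 2; the other orientation follows by ≈-sym)
  comm    : ∀ (i j : Fin n) → 2 + toℕ i ≤ toℕ j →
            (i ∷ j ∷ []) ≈ (j ∷ i ∷ [])

infix 4 _≈_

-- Rooks are handled as lists of naturals, and the generator π_k as the number k.  Every rook s
-- of size n is produced from 1_n by an explicit word normalForm n s, built by recursion on n: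
-- if the letter n occurs, s = a n b, a word for the smaller rook a b is followed by the run that
-- carries n from the last position back to its place; otherwise s = a 0 b with 0 the first zero,
-- and the word continues with placeZero, which replaces the last letter n by a 0 at that place.
-- The heart of the proof is that normalForm t followed by any word w equals normalForm (t · w)
-- in R_n^0.  It is checked one generator at a time, by induction on n and a case split on where
-- the generator acts relative to the letter n (or to the first 0), using only the defining
-- relations of R_n^0.  For t = 1_n the normal form is empty, so every word w equals
-- normalForm (1_n · w): this gives uniqueness and the multiplication rule, and normalForm s
-- itself gives existence.

module Submission where

open import Defs
open import Data.Nat using (ℕ; zero; suc; pred; _+_; _≤_; _<_; z≤n; s≤s; _<?_; _≟_)
open import Data.Nat.Properties
  using ( +-suc; +-comm; +-assoc; +-identityʳ; +-cancelˡ-≤; suc-injective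
        ; ≤-refl; ≤-trans; ≤-pred; n≤1+n; m≤m+n; m<n⇒m<1+n; <⇒≤; <-≤-trans; ≤∧≢⇒<; <⇒≢; ≤⇒≯; 1+n≰n
        ; n≢0⇒n>0; <-cmp; m≤n⇒∃[o]m+o≡n; m+n≤o⇒n≤o )
open import Data.Fin as F using (Fin; toℕ; inject₁)
open import Data.Fin.Properties using (toℕ-injective; toℕ<n; toℕ≤pred[n])
open import Data.Vec as V using (Vec; lookup; tabulate; _[_]≔_; toList)
open import Data.Vec.Properties using (length-toList)
open import Data.List using (List; []; _∷_; _++_; [_]; length; foldl; map; initLast; _∷ʳ′_)
open import Data.List.Properties
  using (++-assoc; ++-identityʳ; length-++; length-++-sucʳ; length-++-≤ˡ; foldl-++; map-++; ∷-injectiveˡ; ∷-injectiveʳ)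
open import Data.List.Relation.Unary.All as All using (All; []; _∷_)
open import Data.List.Relation.Unary.All.Properties using (++⁺; ++⁻ˡ; ++⁻ʳ; map⁺)
open import Data.List.Relation.Unary.AllPairs using (AllPairs; []; _∷_)
open import Data.List.Relation.Binary.Permutation.Propositional using (_↭_; ↭-refl; ↭-prep; ↭-swap)
open import Data.List.Relation.Binary.Permutation.Propositional.Properties using (↭-length; All-resp-↭)
open import Data.Bool using (true; false; if_then_else_)
open import Data.Maybe as Maybe using (Maybe; just; nothing)
open import Data.Product as Product using (Σ; _×_; _,_; proj₁; proj₂)
open import Data.Sum using (_⊎_; inj₁; inj₂)
open import Data.Empty using (⊥-elim)
open import Function using (_∘_)
open import Level using (0ℓ)
open import Relation.Nullary using (does; yes; no)
open import Relation.Nullary.Decidable using (dec-true; dec-false)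
open import Relation.Binary using (Setoid; tri<; tri≈; tri>)
open import Relation.Binary.PropositionalEquality hiding ([_])

-- Rooks as lists of naturals

swapAt : ℕ → List ℕ → List ℕ
swapAt zero    (x ∷ y ∷ t) = if does (x <? y) then y ∷ x ∷ t else x ∷ y ∷ t
swapAt zero    t           = t
swapAt (suc k) []          = []
swapAt (suc k) (x ∷ t)     = x ∷ swapAt k t

eraseHead : List ℕ → List ℕ
eraseHead []      = []
eraseHead (_ ∷ t) = 0 ∷ t

actGenℕ : List ℕ → ℕ → List ℕ
actGenℕ s zero    = eraseHead s
actGenℕ s (suc k) = swapAt k s

infixl 6 _·ℕ_
_·ℕ_ : List ℕ → List ℕ → List ℕ
_·ℕ_ = foldl actGenℕ

·ℕ-++ : ∀ s u v → s ·ℕ (u ++ v) ≡ s ·ℕ u ·ℕ v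
·ℕ-++ = foldl-++ actGenℕ

swapAt-↭ : ∀ k s → s ↭ swapAt k s
swapAt-↭ zero    []          = ↭-refl
swapAt-↭ zero    (x ∷ [])    = ↭-refl
swapAt-↭ zero    (x ∷ y ∷ t) with does (x <? y)
... | true  = ↭-swap x y ↭-refl
... | false = ↭-refl
swapAt-↭ (suc k) []          = ↭-refl
swapAt-↭ (suc k) (x ∷ t)     = ↭-prep x (swapAt-↭ k t)

length-swapAt : ∀ k s → length (swapAt k s) ≡ length s
length-swapAt k s = sym (↭-length (swapAt-↭ k s))

length-actGenℕ : ∀ s g → length (actGenℕ s g) ≡ length s
length-actGenℕ []      zero    = refl
length-actGenℕ (_ ∷ _) zero    = refl
length-actGenℕ s       (suc k) = length-swapAt k s

All-swapAt : ∀ {P : ℕ → Set} k s → All P s → All P (swapAt k s)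
All-swapAt k s = All-resp-↭ (swapAt-↭ k s)

All-actGenℕ : ∀ {P : ℕ → Set} → P 0 → ∀ s g → All P s → All P (actGenℕ s g)
All-actGenℕ p0 []      zero    ps       = ps
All-actGenℕ p0 (_ ∷ _) zero    (_ ∷ ps) = p0 ∷ ps
All-actGenℕ p0 s       (suc k) ps       = All-swapAt k s ps

swapAt-++ʳ : ∀ a k t → swapAt (length a + k) (a ++ t) ≡ a ++ swapAt k t
swapAt-++ʳ []      k t = refl
swapAt-++ʳ (x ∷ a) k t = cong (x ∷_) (swapAt-++ʳ a k t)

swapAt-rise : ∀ a {x y} t → x < y → swapAt (length a) (a ++ x ∷ y ∷ t) ≡ a ++ y ∷ x ∷ t
swapAt-rise []      {x} {y} t x<y rewrite dec-true (x <? y) x<y = refl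
swapAt-rise (z ∷ a)         t x<y = cong (z ∷_) (swapAt-rise a t x<y)

swapAt-fixed : ∀ a {x y} t → y ≤ x → swapAt (length a) (a ++ x ∷ y ∷ t) ≡ a ++ x ∷ y ∷ t
swapAt-fixed []      {x} {y} t y≤x rewrite dec-false (x <? y) (≤⇒≯ y≤x) = refl
swapAt-fixed (z ∷ a)         t y≤x = cong (z ∷_) (swapAt-fixed a t y≤x)

swapAt-++ˡ : ∀ k a t → suc k < length a → swapAt k (a ++ t) ≡ swapAt k a ++ t
swapAt-++ˡ zero    (x ∷ y ∷ a) t _ with does (x <? y)
... | true  = refl
... | false = refl
swapAt-++ˡ zero    (x ∷ [])    t (s≤s ())
swapAt-++ˡ (suc k) (x ∷ a)     t (s≤s k<a) = cong (x ∷_) (swapAt-++ˡ k a t k<a)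

actGenℕ-++ˡ : ∀ g a t → g < length a → actGenℕ (a ++ t) g ≡ actGenℕ a g ++ t
actGenℕ-++ˡ zero    (x ∷ a) t _   = refl
actGenℕ-++ˡ (suc k) a       t k<a = swapAt-++ˡ k a t k<a

·ℕ-++ˡ : ∀ a t w → All (_< length a) w → (a ++ t) ·ℕ w ≡ a ·ℕ w ++ t
·ℕ-++ˡ a t []      []          = refl
·ℕ-++ˡ a t (g ∷ w) (g<a ∷ w<a) rewrite actGenℕ-++ˡ g a t g<a =
  ·ℕ-++ˡ (actGenℕ a g) t w (subst (λ m → All (_< m) w) (sym (length-actGenℕ a g)) w<a)

length-snoc : ∀ (a : List ℕ) y → length (a ++ [ y ]) ≡ suc (length a)
length-snoc a y = trans (length-++-sucʳ a y []) (cong (suc ∘ length) (++-identityʳ a))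

asc : ℕ → ℕ → List ℕ
asc zero    l = []
asc (suc k) l = l ∷ asc k (suc l)

desc : ℕ → ℕ → List ℕ
desc zero    l = []
desc (suc k) l = l + k ∷ desc k l

asc-suc : ∀ k l → asc (suc k) l ≡ asc k l ++ [ l + k ]
asc-suc zero    l = cong [_] (sym (+-identityʳ l))
asc-suc (suc k) l = cong (l ∷_) (trans (asc-suc k (suc l)) (cong (λ m → asc k (suc l) ++ [ m ]) (sym (+-suc l k))))

desc-suc : ∀ k l → desc (suc k) l ≡ desc k (suc l) ++ [ l ]
desc-suc zero    l = cong [_] (+-identityʳ l)
desc-suc (suc k) l = cong₂ _∷_ (+-suc l k) (desc-suc k l)

asc-+ : ∀ j k l → asc (j + k) l ≡ asc j l ++ asc k (l + j)
asc-+ zero    k l = cong (asc k) (sym (+-identityʳ l))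
asc-+ (suc j) k l = cong (l ∷_) (trans (asc-+ j k (suc l)) (cong (λ m → asc j (suc l) ++ asc k m) (sym (+-suc l j))))

desc-+ : ∀ j k l → desc (j + k) l ≡ desc j (l + k) ++ desc k l
desc-+ zero    k l = refl
desc-+ (suc j) k l = cong₂ _∷_ (trans (cong (l +_) (+-comm j k)) (sym (+-assoc l k j))) (desc-+ j k l)

length-asc : ∀ k l → length (asc k l) ≡ k
length-asc zero    l = refl
length-asc (suc k) l = cong suc (length-asc k (suc l))

asc-≥ : ∀ k l → All (l ≤_) (asc k l)
asc-≥ zero    l = []
asc-≥ (suc k) l = ≤-refl ∷ All.map (≤-trans (n≤1+n l)) (asc-≥ k (suc l))

asc-< : ∀ k l → All (_< l + k) (asc k l)
asc-< zero    l = []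
asc-< (suc k) l = subst (λ m → All (_< m) (asc (suc k) l)) (sym (+-suc l k)) (s≤s (m≤m+n l k) ∷ asc-< k (suc l))

desc-≥ : ∀ k l → All (l ≤_) (desc k l)
desc-≥ zero    l = []
desc-≥ (suc k) l = m≤m+n l k ∷ desc-≥ k l

desc-< : ∀ k l → All (_< l + k) (desc k l)
desc-< zero    l = []
desc-< (suc k) l = subst (λ m → All (_< m) (desc (suc k) l)) (sym (+-suc l k)) (≤-refl ∷ All.map m<n⇒m<1+n (desc-< k l))

map-suc-asc : ∀ k l → map suc (asc k l) ≡ asc k (suc l)
map-suc-asc zero    l = refl
map-suc-asc (suc k) l = cong (suc l ∷_) (map-suc-asc k (suc l))

map-pred-asc : ∀ k l → map pred (asc k (suc l)) ≡ asc k l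
map-pred-asc zero    l = refl
map-pred-asc (suc k) l = cong (l ∷_) (map-pred-asc k (suc l))

desc-moveLeft : ∀ a b {N} → All (_< N) b →
  (a ++ b ++ [ N ]) ·ℕ desc (length b) (suc (length a)) ≡ a ++ N ∷ b
desc-moveLeft a []      []          = refl
desc-moveLeft a (y ∷ b) {N} (y<N ∷ b<N) = begin
    (a ++ y ∷ b ++ [ N ]) ·ℕ desc (suc (length b)) (suc (length a))
  ≡⟨ cong ((a ++ y ∷ b ++ [ N ]) ·ℕ_) (desc-suc (length b) (suc (length a))) ⟩
    (a ++ y ∷ b ++ [ N ]) ·ℕ (desc (length b) (suc (suc (length a))) ++ [ suc (length a) ])
  ≡⟨ ·ℕ-++ (a ++ y ∷ b ++ [ N ]) (desc (length b) (suc (suc (length a)))) _ ⟩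
    swapAt (length a) ((a ++ y ∷ b ++ [ N ]) ·ℕ desc (length b) (suc (suc (length a))))
  ≡⟨ cong₂ (λ s p → swapAt (length a) (s ·ℕ desc (length b) (suc p)))
           (sym (++-assoc a [ y ] (b ++ [ N ]))) (sym (length-snoc a y)) ⟩
    swapAt (length a) (((a ++ [ y ]) ++ b ++ [ N ]) ·ℕ desc (length b) (suc (length (a ++ [ y ]))))
  ≡⟨ cong (swapAt (length a)) (desc-moveLeft (a ++ [ y ]) b b<N) ⟩
    swapAt (length a) ((a ++ [ y ]) ++ N ∷ b)
  ≡⟨ cong (swapAt (length a)) (++-assoc a [ y ] (N ∷ b)) ⟩
    swapAt (length a) (a ++ y ∷ N ∷ b)
  ≡⟨ swapAt-rise a b y<N ⟩
    a ++ N ∷ y ∷ b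
  ∎
  where open ≡-Reasoning

asc-moveZero : ∀ c a t → All (_≢ 0) a →
  (c ++ 0 ∷ a ++ t) ·ℕ asc (length a) (suc (length c)) ≡ c ++ a ++ 0 ∷ t
asc-moveZero c []      t []          = refl
asc-moveZero c (y ∷ a) t (y≢0 ∷ a≢0) = begin
    swapAt (length c) (c ++ 0 ∷ y ∷ a ++ t) ·ℕ asc (length a) (suc (suc (length c)))
  ≡⟨ cong (_·ℕ asc (length a) (suc (suc (length c)))) (swapAt-rise c (a ++ t) (n≢0⇒n>0 y≢0)) ⟩
    (c ++ y ∷ 0 ∷ a ++ t) ·ℕ asc (length a) (suc (suc (length c)))
  ≡⟨ cong₂ (λ s p → s ·ℕ asc (length a) (suc p)) (sym (++-assoc c [ y ] (0 ∷ a ++ t))) (sym (length-snoc c y)) ⟩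
    ((c ++ [ y ]) ++ 0 ∷ a ++ t) ·ℕ asc (length a) (suc (length (c ++ [ y ])))
  ≡⟨ asc-moveZero (c ++ [ y ]) a t a≢0 ⟩
    (c ++ [ y ]) ++ a ++ 0 ∷ t
  ≡⟨ ++-assoc c [ y ] (a ++ 0 ∷ t) ⟩
    c ++ y ∷ a ++ 0 ∷ t
  ∎
  where open ≡-Reasoning

-- desc (suc n) 0 carries the last letter to the front, π_0 erases it, and asc q 1 moves the
-- resulting 0 to position q.
placeZero : ℕ → ℕ → List ℕ
placeZero n q = desc (suc n) 0 ++ asc q 1

placeZero-correct : ∀ a b {n} → length a + length b ≡ n → All (_≢ 0) a → All (_< suc n) (a ++ b) →
  (a ++ b ++ [ suc n ]) ·ℕ placeZero n (length a) ≡ a ++ 0 ∷ b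
placeZero-correct a b {n} len a≢0 ab<n = begin
    (a ++ b ++ [ suc n ]) ·ℕ (desc (suc n) 0 ++ asc (length a) 1)
  ≡⟨ cong (λ w → (a ++ b ++ [ suc n ]) ·ℕ (w ++ asc (length a) 1)) (desc-suc n 0) ⟩
    (a ++ b ++ [ suc n ]) ·ℕ ((desc n 1 ++ [ 0 ]) ++ asc (length a) 1)
  ≡⟨ ·ℕ-++ (a ++ b ++ [ suc n ]) (desc n 1 ++ [ 0 ]) (asc (length a) 1) ⟩
    (a ++ b ++ [ suc n ]) ·ℕ (desc n 1 ++ [ 0 ]) ·ℕ asc (length a) 1
  ≡⟨ cong (_·ℕ asc (length a) 1) (·ℕ-++ (a ++ b ++ [ suc n ]) (desc n 1) [ 0 ]) ⟩
    eraseHead ((a ++ b ++ [ suc n ]) ·ℕ desc n 1) ·ℕ asc (length a) 1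
  ≡⟨ cong₂ (λ s m → eraseHead (s ·ℕ desc m 1) ·ℕ asc (length a) 1)
           (sym (++-assoc a b [ suc n ])) (sym (trans (length-++ a) len)) ⟩
    eraseHead (((a ++ b) ++ [ suc n ]) ·ℕ desc (length (a ++ b)) 1) ·ℕ asc (length a) 1
  ≡⟨ cong (λ s → eraseHead s ·ℕ asc (length a) 1) (desc-moveLeft [] (a ++ b) ab<n) ⟩
    (0 ∷ a ++ b) ·ℕ asc (length a) 1
  ≡⟨ asc-moveZero [] a b a≢0 ⟩
    a ++ 0 ∷ b
  ∎
  where open ≡-Reasoning

Compatible : ℕ → ℕ → Set
Compatible x y = x ≡ y → x ≡ 0

Distinct : List ℕ → Set
Distinct = AllPairs Compatible

record IsRookList (n : ℕ) (s : List ℕ) : Set where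
  constructor isRookList
  field
    length≡  : length s ≡ n
    bounded  : All (_≤ n) s
    distinct : Distinct s

compatible-sym : ∀ {x y} → Compatible x y → Compatible y x
compatible-sym c refl = c refl

compatible-suc : ∀ {m y} → Compatible (suc m) y → y ≢ suc m
compatible-suc c refl with c refl
... | ()

Distinct-swapAt : ∀ k s → Distinct s → Distinct (swapAt k s)
Distinct-swapAt zero    []          d = d
Distinct-swapAt zero    (x ∷ [])    d = d
Distinct-swapAt zero    (x ∷ y ∷ t) d@((cxy ∷ cxt) ∷ cyt ∷ dt) with does (x <? y)
... | true  = (compatible-sym cxy ∷ cyt) ∷ cxt ∷ dt
... | false = d
Distinct-swapAt (suc k) []          d = d
Distinct-swapAt (suc k) (x ∷ t)     (cxt ∷ dt) = All-swapAt k t cxt ∷ Distinct-swapAt k t dt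

Distinct-0∷ : ∀ {s} → Distinct s → Distinct (0 ∷ s)
Distinct-0∷ {s} d = All.universal (λ _ _ → refl) s ∷ d

Distinct-actGenℕ : ∀ s g → Distinct s → Distinct (actGenℕ s g)
Distinct-actGenℕ []      zero    d        = d
Distinct-actGenℕ (_ ∷ t) zero    (_ ∷ dt) = Distinct-0∷ dt
Distinct-actGenℕ s       (suc k) d        = Distinct-swapAt k s d

IsRookList-actGenℕ : ∀ {n s} g → IsRookList n s → IsRookList n (actGenℕ s g)
IsRookList-actGenℕ {s = s} g (isRookList len bd d) =
  isRookList (trans (length-actGenℕ s g) len) (All-actGenℕ z≤n s g bd) (Distinct-actGenℕ s g d)

All-remove : ∀ {P : ℕ → Set} a {x} b → All P (a ++ x ∷ b) → P x × All P (a ++ b)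
All-remove a b p with ++⁻ʳ a p
... | px ∷ pb = px , ++⁺ (++⁻ˡ a p) pb

Distinct-remove : ∀ a {x} b → Distinct (a ++ x ∷ b) → All (Compatible x) b × Distinct (a ++ b)
Distinct-remove []      b (cxb ∷ db) = cxb , db
Distinct-remove (y ∷ a) b (cy ∷ d) =
  proj₁ (Distinct-remove a b d) , proj₂ (All-remove a b cy) ∷ proj₂ (Distinct-remove a b d)

bounded-lower : ∀ {m s} → All (_≤ suc m) s → All (_≢ suc m) s → All (_≤ m) s
bounded-lower ≤s ≢s = All.zipWith (λ (x≤ , x≢) → ≤-pred (≤∧≢⇒< x≤ x≢)) (≤s , ≢s)

bounded-removeMax : ∀ {m} a b → All (_≢ suc m) a → All (_≤ suc m) (a ++ suc m ∷ b) → Distinct (a ++ suc m ∷ b) →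
  All (_≤ m) (a ++ b)
bounded-removeMax a b a≢m bd d =
  bounded-lower (proj₂ (All-remove a b bd)) (++⁺ a≢m (All.map compatible-suc (proj₁ (Distinct-remove a b d))))

IsRookList-zeroToFront : ∀ {n} a b → IsRookList n (a ++ 0 ∷ b) → IsRookList n (0 ∷ a ++ b)
IsRookList-zeroToFront a b (isRookList len bd d) =
  isRookList (trans (sym (length-++-sucʳ a 0 b)) len)
             (z≤n ∷ proj₂ (All-remove a b bd))
             (Distinct-0∷ (proj₂ (Distinct-remove a b d)))

Distinct-asc : ∀ k l → Distinct (asc k l)
Distinct-asc zero    l = []
Distinct-asc (suc k) l = All.map (λ l<y l≡y → ⊥-elim (<⇒≢ l<y l≡y)) (asc-≥ k (suc l)) ∷ Distinct-asc k (suc l)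

IsRookList-asc : ∀ n → IsRookList n (asc n 1)
IsRookList-asc n = isRookList (length-asc n 1) (All.map ≤-pred (asc-< n 1)) (Distinct-asc n 1)

data Occurrence (x : ℕ) : List ℕ → Set where
  found  : ∀ a b → All (_≢ x) a → Occurrence x (a ++ x ∷ b)
  absent : ∀ {s} → All (_≢ x) s → Occurrence x s

occurrence : ∀ x s → Occurrence x s
occurrence x []      = absent []
occurrence x (y ∷ s) with y ≟ x
... | yes refl = found [] s []
... | no y≢x with occurrence x s
...   | found a b a≢x = found (y ∷ a) b (y≢x ∷ a≢x)
...   | absent s≢x    = absent (y≢x ∷ s≢x)

zeroFree-length≤ : ∀ n s → All (_≢ 0) s → All (_≤ n) s → Distinct s → length s ≤ n
zeroFree-length≤ zero    []      _          _          _ = z≤n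
zeroFree-length≤ zero    (x ∷ s) (x≢0 ∷ _)  (z≤n ∷ _)  _ = ⊥-elim (x≢0 refl)
zeroFree-length≤ (suc n) s       s≢0        bd         d with occurrence (suc n) s
... | found a b a≢n = subst (_≤ suc n) (sym (length-++-sucʳ a (suc n) b))
        (s≤s (zeroFree-length≤ n (a ++ b) (proj₂ (All-remove a b s≢0))
               (bounded-removeMax a b a≢n bd d) (proj₂ (Distinct-remove a b d))))
... | absent s≢n = ≤-trans (zeroFree-length≤ n s s≢0 (bounded-lower bd s≢n) d) (n≤1+n n)

data Shape (n : ℕ) : List ℕ → Set where
  withMax    : ∀ a b → All (_≢ suc n) a → IsRookList n (a ++ b) → Shape n (a ++ suc n ∷ b)
  withoutMax : ∀ a b → All (_≢ suc n) (a ++ 0 ∷ b) → All (_≢ 0) a → IsRookList n (a ++ b) →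
               Shape n (a ++ 0 ∷ b)

shape : ∀ n s → IsRookList (suc n) s → Shape n s
shape n s (isRookList len bd d) with occurrence (suc n) s
... | found a b a≢n = withMax a b a≢n
        (isRookList (suc-injective (trans (sym (length-++-sucʳ a _ b)) len))
                    (bounded-removeMax a b a≢n bd d) (proj₂ (Distinct-remove a b d)))
... | absent s≢n with occurrence 0 s
...   | found a b a≢0 = withoutMax a b s≢n a≢0
          (isRookList (suc-injective (trans (sym (length-++-sucʳ a _ b)) len))
                      (bounded-lower (proj₂ (All-remove a b bd)) (proj₂ (All-remove a b s≢n)))
                      (proj₂ (Distinct-remove a b d)))
...   | absent s≢0 = ⊥-elim (1+n≰n (subst (_≤ n) len (zeroFree-length≤ n s s≢0 (bounded-lower bd s≢n) d)))

-- The normal form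

splitAtFirst : ℕ → List ℕ → Maybe (List ℕ × List ℕ)
splitAtFirst x []      = nothing
splitAtFirst x (y ∷ s) = if does (y ≟ x) then just ([] , s) else Maybe.map (Product.map₁ (y ∷_)) (splitAtFirst x s)

splitAtFirst-found : ∀ x a b → All (_≢ x) a → splitAtFirst x (a ++ x ∷ b) ≡ just (a , b)
splitAtFirst-found x []      b []          rewrite dec-true (x ≟ x) refl = refl
splitAtFirst-found x (y ∷ a) b (y≢x ∷ a≢x) rewrite dec-false (y ≟ x) y≢x | splitAtFirst-found x a b a≢x = refl

splitAtFirst-absent : ∀ x s → All (_≢ x) s → splitAtFirst x s ≡ nothing
splitAtFirst-absent x []      []          = refl
splitAtFirst-absent x (y ∷ s) (y≢x ∷ s≢x) rewrite dec-false (y ≟ x) y≢x | splitAtFirst-absent x s s≢x = refl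

normalForm : ℕ → List ℕ → List ℕ
normalForm zero    s = []
normalForm (suc n) s with splitAtFirst (suc n) s | splitAtFirst 0 s
... | just (a , b) | _            = normalForm n (a ++ b) ++ desc (length b) (suc (length a))
... | nothing      | just (a , b) = normalForm n (a ++ b) ++ placeZero n (length a)
... | nothing      | nothing      = []

normalForm-withMax : ∀ n a b → All (_≢ suc n) a →
  normalForm (suc n) (a ++ suc n ∷ b) ≡ normalForm n (a ++ b) ++ desc (length b) (suc (length a))
normalForm-withMax n a b a≢n rewrite splitAtFirst-found (suc n) a b a≢n = refl

normalForm-withoutMax : ∀ n a b → All (_≢ suc n) (a ++ 0 ∷ b) → All (_≢ 0) a →
  normalForm (suc n) (a ++ 0 ∷ b) ≡ normalForm n (a ++ b) ++ placeZero n (length a)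
normalForm-withoutMax n a b s≢n a≢0
  rewrite splitAtFirst-absent (suc n) (a ++ 0 ∷ b) s≢n | splitAtFirst-found 0 a b a≢0 = refl

lengths-sum : ∀ {n} a b → IsRookList n (a ++ b) → length a + length b ≡ n
lengths-sum a b rk = trans (sym (length-++ a)) (IsRookList.length≡ rk)

prefix-length≤ : ∀ {n} a b → IsRookList n (a ++ b) → length a ≤ n
prefix-length≤ a b rk = subst (length a ≤_) (IsRookList.length≡ rk) (length-++-≤ˡ a)

normalForm-< : ∀ n s → IsRookList n s → All (_< n) (normalForm n s)
normalForm-< zero    s rk = []
normalForm-< (suc n) s rk with shape n s rk
... | withMax a b a≢n rk′ rewrite normalForm-withMax n a b a≢n =
  ++⁺ (All.map m<n⇒m<1+n (normalForm-< n (a ++ b) rk′))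
      (subst (λ m → All (_< m) (desc (length b) (suc (length a)))) (cong suc (lengths-sum a b rk′))
             (desc-< (length b) (suc (length a))))
... | withoutMax a b s≢n a≢0 rk′ rewrite normalForm-withoutMax n a b s≢n a≢0 =
  ++⁺ (All.map m<n⇒m<1+n (normalForm-< n (a ++ b) rk′))
      (++⁺ (desc-< (suc n) 0) (All.map (λ p → ≤-trans p (s≤s (prefix-length≤ a b rk′))) (asc-< (length a) 1)))

normalForm-asc : ∀ n → normalForm n (asc n 1) ≡ []
normalForm-asc zero    = refl
normalForm-asc (suc n) = begin
    normalForm (suc n) (asc (suc n) 1)
  ≡⟨ cong (normalForm (suc n)) (asc-suc n 1) ⟩
    normalForm (suc n) (asc n 1 ++ [ suc n ])
  ≡⟨ normalForm-withMax n (asc n 1) [] (All.map <⇒≢ (asc-< n 1)) ⟩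
    normalForm n (asc n 1 ++ []) ++ []
  ≡⟨ trans (++-identityʳ _) (cong (normalForm n) (++-identityʳ _)) ⟩
    normalForm n (asc n 1)
  ≡⟨ normalForm-asc n ⟩
    []
  ∎
  where open ≡-Reasoning

asc-·ℕ-extend : ∀ n {t} v w → All (_< n) v → asc n 1 ·ℕ v ≡ t →
  asc (suc n) 1 ·ℕ (v ++ w) ≡ (t ++ [ suc n ]) ·ℕ w
asc-·ℕ-extend n {t} v w v<n v-t = begin
    asc (suc n) 1 ·ℕ (v ++ w)
  ≡⟨ ·ℕ-++ (asc (suc n) 1) v w ⟩
    asc (suc n) 1 ·ℕ v ·ℕ w
  ≡⟨ cong (λ s → s ·ℕ v ·ℕ w) (asc-suc n 1) ⟩
    (asc n 1 ++ [ suc n ]) ·ℕ v ·ℕ w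
  ≡⟨ cong (_·ℕ w) (·ℕ-++ˡ (asc n 1) [ suc n ] v (subst (λ m → All (_< m) v) (sym (length-asc n 1)) v<n)) ⟩
    (asc n 1 ·ℕ v ++ [ suc n ]) ·ℕ w
  ≡⟨ cong (λ s → (s ++ [ suc n ]) ·ℕ w) v-t ⟩
    (t ++ [ suc n ]) ·ℕ w
  ∎
  where open ≡-Reasoning

normalForm-correct : ∀ n s → IsRookList n s → asc n 1 ·ℕ normalForm n s ≡ s
normalForm-correct zero    []      _ = refl
normalForm-correct zero    (_ ∷ _) (isRookList () _ _)
normalForm-correct (suc n) s rk with shape n s rk
... | withMax a b a≢n rk′ = begin
    asc (suc n) 1 ·ℕ normalForm (suc n) (a ++ suc n ∷ b)
  ≡⟨ cong (asc (suc n) 1 ·ℕ_) (normalForm-withMax n a b a≢n) ⟩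
    asc (suc n) 1 ·ℕ (normalForm n (a ++ b) ++ desc (length b) (suc (length a)))
  ≡⟨ asc-·ℕ-extend n _ _ (normalForm-< n (a ++ b) rk′) (normalForm-correct n (a ++ b) rk′) ⟩
    ((a ++ b) ++ [ suc n ]) ·ℕ desc (length b) (suc (length a))
  ≡⟨ cong (_·ℕ desc (length b) (suc (length a))) (++-assoc a b [ suc n ]) ⟩
    (a ++ b ++ [ suc n ]) ·ℕ desc (length b) (suc (length a))
  ≡⟨ desc-moveLeft a b (All.map s≤s (++⁻ʳ a (IsRookList.bounded rk′))) ⟩
    a ++ suc n ∷ b
  ∎
  where open ≡-Reasoning
... | withoutMax a b s≢n a≢0 rk′ = begin
    asc (suc n) 1 ·ℕ normalForm (suc n) (a ++ 0 ∷ b)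
  ≡⟨ cong (asc (suc n) 1 ·ℕ_) (normalForm-withoutMax n a b s≢n a≢0) ⟩
    asc (suc n) 1 ·ℕ (normalForm n (a ++ b) ++ placeZero n (length a))
  ≡⟨ asc-·ℕ-extend n _ _ (normalForm-< n (a ++ b) rk′) (normalForm-correct n (a ++ b) rk′) ⟩
    ((a ++ b) ++ [ suc n ]) ·ℕ placeZero n (length a)
  ≡⟨ cong (_·ℕ placeZero n (length a)) (++-assoc a b [ suc n ]) ⟩
    (a ++ b ++ [ suc n ]) ·ℕ placeZero n (length a)
  ≡⟨ placeZero-correct a b (lengths-sum a b rk′) a≢0 (All.map s≤s (IsRookList.bounded rk′)) ⟩
    a ++ 0 ∷ b
  ∎
  where open ≡-Reasoning

-- Words over ℕ in R^0_{M+1}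

clamp : (m : ℕ) → ℕ → Fin (suc m)
clamp zero    _       = F.zero
clamp (suc m) zero    = F.zero
clamp (suc m) (suc k) = F.suc (clamp m k)

toℕ-clamp : ∀ m {k} → k ≤ m → toℕ (clamp m k) ≡ k
toℕ-clamp zero    {zero}  _       = refl
toℕ-clamp (suc m) {zero}  _       = refl
toℕ-clamp (suc m) {suc k} (s≤s p) = cong suc (toℕ-clamp m p)

clamp-toℕ : ∀ m (i : Fin (suc m)) → clamp m (toℕ i) ≡ i
clamp-toℕ zero    F.zero    = refl
clamp-toℕ (suc m) F.zero    = refl
clamp-toℕ (suc m) (F.suc i) = cong F.suc (clamp-toℕ m i)

Distant : ℕ → ℕ → Set
Distant x y = 2 + x ≤ y ⊎ 2 + y ≤ x

module WordCongruence (M : ℕ) where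

  -- Letters are read as generators through clamp M, which is faithful only on letters ≤ M;
  -- hence the bounds carried by every lemma below.
  infix 4 _≈ℕ_
  _≈ℕ_ : List ℕ → List ℕ → Set
  u ≈ℕ v = map (clamp M) u ≈ map (clamp M) v

  ≈ℕ-setoid : Setoid 0ℓ 0ℓ
  ≈ℕ-setoid = record
    { Carrier       = List ℕ
    ; _≈_           = _≈ℕ_
    ; isEquivalence = record { refl = ≈-refl ; sym = ≈-sym ; trans = ≈-trans }
    }

  open Setoid ≈ℕ-setoid public using ()
    renaming (refl to ≈ℕ-refl; sym to ≈ℕ-sym; trans to ≈ℕ-trans; reflexive to ≈ℕ-reflexive)
  open import Relation.Binary.Reasoning.Setoid ≈ℕ-setoid public

  ≈ℕ-cong : ∀ {u u′ v v′} → u ≈ℕ u′ → v ≈ℕ v′ → u ++ v ≈ℕ u′ ++ v′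
  ≈ℕ-cong {u} {u′} {v} {v′} p q =
    subst₂ _≈_ (sym (map-++ (clamp M) u v)) (sym (map-++ (clamp M) u′ v′)) (≈-cong p q)

  ≈ℕ-congˡ : ∀ u {v v′} → v ≈ℕ v′ → u ++ v ≈ℕ u ++ v′
  ≈ℕ-congˡ u = ≈ℕ-cong (≈ℕ-refl {u})

  ≈ℕ-congʳ : ∀ {u u′} v → u ≈ℕ u′ → u ++ v ≈ℕ u′ ++ v
  ≈ℕ-congʳ v p = ≈ℕ-cong p (≈ℕ-refl {v})

  ≈ℕ-idem : ∀ x → x ∷ x ∷ [] ≈ℕ [ x ]
  ≈ℕ-idem x = idem (clamp M x)

  ≈ℕ-comm : ∀ {x y} → 2 + x ≤ y → y ≤ M → x ∷ y ∷ [] ≈ℕ y ∷ x ∷ []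
  ≈ℕ-comm {x} {y} x+2≤y y≤M = comm (clamp M x) (clamp M y)
    (subst₂ (λ a b → 2 + a ≤ b) (sym (toℕ-clamp M x≤M)) (sym (toℕ-clamp M y≤M)) x+2≤y)
    where x≤M = m+n≤o⇒n≤o 2 (≤-trans x+2≤y y≤M)

  ≈ℕ-distant : ∀ {x y} → Distant x y → x ≤ M → y ≤ M → x ∷ y ∷ [] ≈ℕ y ∷ x ∷ []
  ≈ℕ-distant (inj₁ x+2≤y) _   y≤M = ≈ℕ-comm x+2≤y y≤M
  ≈ℕ-distant (inj₂ y+2≤x) x≤M _   = ≈ℕ-sym (≈ℕ-comm y+2≤x x≤M)

  ≈ℕ-braid : ∀ {x} → 1 ≤ x → suc x ≤ M → x ∷ suc x ∷ x ∷ [] ≈ℕ suc x ∷ x ∷ suc x ∷ []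
  ≈ℕ-braid {x} 1≤x x<M = braid (clamp M x) (clamp M (suc x))
    (subst (1 ≤_) (sym x≡) 1≤x) (trans (toℕ-clamp M x<M) (cong suc (sym x≡)))
    where x≡ = toℕ-clamp M (≤-trans (n≤1+n x) x<M)

  ≈ℕ-rookL : 1 ≤ M → 1 ∷ 0 ∷ 1 ∷ 0 ∷ [] ≈ℕ 0 ∷ 1 ∷ 0 ∷ []
  ≈ℕ-rookL 1≤M = rookL (clamp M 0) (clamp M 1) (toℕ-clamp M z≤n) (toℕ-clamp M 1≤M)

  ≈ℕ-rookR : 1 ≤ M → 0 ∷ 1 ∷ 0 ∷ [] ≈ℕ 0 ∷ 1 ∷ 0 ∷ 1 ∷ []
  ≈ℕ-rookR 1≤M = rookR (clamp M 0) (clamp M 1) (toℕ-clamp M z≤n) (toℕ-clamp M 1≤M)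

  ≈ℕ-idem-end : ∀ {W} X x → W ≡ X ++ [ x ] → W ++ [ x ] ≈ℕ W
  ≈ℕ-idem-end X x refl = begin
    (X ++ [ x ]) ++ [ x ] ≡⟨ ++-assoc X [ x ] [ x ] ⟩
    X ++ x ∷ x ∷ []       ≈⟨ ≈ℕ-congˡ X (≈ℕ-idem x) ⟩
    X ++ [ x ]            ∎

  commute-distant : ∀ x R → All (Distant x) R → All (_≤ M) R → x ≤ M → x ∷ R ≈ℕ R ++ [ x ]
  commute-distant x []      _        _        _   = ≈ℕ-refl
  commute-distant x (y ∷ R) (d ∷ ds) (y≤ ∷ R≤) x≤M = begin
    x ∷ y ∷ R     ≈⟨ ≈ℕ-congʳ R (≈ℕ-distant d x≤M y≤) ⟩
    y ∷ x ∷ R     ≈⟨ ≈ℕ-congˡ [ y ] (commute-distant x R ds R≤ x≤M) ⟩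
    y ∷ R ++ [ x ] ∎

  push-through : ∀ (f : ℕ → ℕ) X W → All (λ g → X ++ [ g ] ≈ℕ f g ∷ X) W → X ++ W ≈ℕ map f W ++ X
  push-through f X []      []       = ≈ℕ-reflexive (++-identityʳ X)
  push-through f X (g ∷ W) (p ∷ ps) = begin
    X ++ g ∷ W            ≡⟨ ++-assoc X [ g ] W ⟨
    (X ++ [ g ]) ++ W     ≈⟨ ≈ℕ-congʳ W p ⟩
    f g ∷ X ++ W          ≈⟨ ≈ℕ-congˡ [ f g ] (push-through f X W ps) ⟩
    f g ∷ map f W ++ X    ∎

  braid-down : ∀ X Y c → 1 ≤ c → All (λ x → 2 + c ≤ x) X → All (_< c) Y → All (_≤ M) (X ++ suc c ∷ c ∷ Y) →
    (X ++ suc c ∷ c ∷ Y) ++ [ suc c ] ≈ℕ c ∷ X ++ suc c ∷ c ∷ Y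
  braid-down X Y c 1≤c X≥ Y< bd with ++⁻ʳ X bd
  ... | c<M ∷ _ ∷ Y≤M = begin
    (X ++ suc c ∷ c ∷ Y) ++ [ suc c ] ≡⟨ ++-assoc X (suc c ∷ c ∷ Y) [ suc c ] ⟩
    X ++ suc c ∷ c ∷ Y ++ [ suc c ]   ≈⟨ ≈ℕ-congˡ X (≈ℕ-congˡ (suc c ∷ c ∷ [])
                                           (commute-distant (suc c) Y (All.map (λ y<c → inj₂ (s≤s y<c)) Y<) Y≤M c<M)) ⟨
    X ++ suc c ∷ c ∷ suc c ∷ Y       ≈⟨ ≈ℕ-congˡ X (≈ℕ-congʳ Y (≈ℕ-braid 1≤c c<M)) ⟨
    X ++ c ∷ suc c ∷ c ∷ Y           ≡⟨ ++-assoc X [ c ] (suc c ∷ c ∷ Y) ⟨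
    (X ++ [ c ]) ++ suc c ∷ c ∷ Y     ≈⟨ ≈ℕ-congʳ (suc c ∷ c ∷ Y)
                                           (commute-distant c X (All.map inj₁ X≥) (++⁻ˡ X bd) (≤-trans (n≤1+n c) c<M)) ⟨
    c ∷ X ++ suc c ∷ c ∷ Y           ∎

  braid-up : ∀ Y Z c → 1 ≤ c → All (_< c) Y → All (λ z → 2 + c ≤ z) Z → All (_≤ M) (Y ++ c ∷ suc c ∷ Z) →
    (Y ++ c ∷ suc c ∷ Z) ++ [ c ] ≈ℕ suc c ∷ Y ++ c ∷ suc c ∷ Z
  braid-up Y Z c 1≤c Y< Z≥ bd with ++⁻ʳ Y bd
  ... | _ ∷ c<M ∷ Z≤M = begin
    (Y ++ c ∷ suc c ∷ Z) ++ [ c ]     ≡⟨ ++-assoc Y (c ∷ suc c ∷ Z) [ c ] ⟩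
    Y ++ c ∷ suc c ∷ Z ++ [ c ]       ≈⟨ ≈ℕ-congˡ Y (≈ℕ-congˡ (c ∷ suc c ∷ [])
                                           (commute-distant c Z (All.map inj₁ Z≥) Z≤M (≤-trans (n≤1+n c) c<M))) ⟨
    Y ++ c ∷ suc c ∷ c ∷ Z           ≈⟨ ≈ℕ-congˡ Y (≈ℕ-congʳ Z (≈ℕ-braid 1≤c c<M)) ⟩
    Y ++ suc c ∷ c ∷ suc c ∷ Z       ≡⟨ ++-assoc Y [ suc c ] (c ∷ suc c ∷ Z) ⟨
    (Y ++ [ suc c ]) ++ c ∷ suc c ∷ Z ≈⟨ ≈ℕ-congʳ (c ∷ suc c ∷ Z)
                                           (commute-distant (suc c) Y (All.map (λ y<c → inj₂ (s≤s y<c)) Y<) (++⁻ˡ Y bd) c<M) ⟨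
    suc c ∷ Y ++ c ∷ suc c ∷ Z       ∎

  bounded-by : ∀ {K} → K ≤ suc M → ∀ {s} → All (_< K) s → All (_≤ M) s
  bounded-by K≤ = All.map (λ p → ≤-pred (≤-trans p K≤))

  desc-lowers : ∀ k l j → 1 ≤ l + j → 2 + j ≤ k → l + k ≤ suc M →
    desc k l ++ [ suc (l + j) ] ≈ℕ l + j ∷ desc k l
  desc-lowers k l j 1≤l+j j+2≤k l+k≤ with m≤n⇒∃[o]m+o≡n j+2≤k
  ... | o , refl = subst (λ D → D ++ [ suc (l + j) ] ≈ℕ l + j ∷ D) (sym split)
    (braid-down (desc o (2 + (l + j))) (desc j l) (l + j) 1≤l+j (desc-≥ o _) (desc-< j l)
                (subst (All (_≤ M)) split (bounded-by l+k≤ (desc-< (2 + j + o) l))))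
    where
    split : desc (2 + j + o) l ≡ desc o (2 + (l + j)) ++ suc (l + j) ∷ l + j ∷ desc j l
    split = trans (cong (λ m → desc m l) (+-comm (2 + j) o))
           (trans (desc-+ o (2 + j) l)
                  (cong₂ (λ a b → desc o a ++ b ∷ l + j ∷ desc j l)
                         (trans (+-suc l (suc j)) (cong suc (+-suc l j))) (+-suc l j)))

  asc-raises : ∀ k l j → 1 ≤ l + j → 2 + j ≤ k → l + k ≤ suc M →
    asc k l ++ [ l + j ] ≈ℕ suc (l + j) ∷ asc k l
  asc-raises k l j 1≤l+j j+2≤k l+k≤ with m≤n⇒∃[o]m+o≡n j+2≤k
  ... | o , refl = subst (λ A → A ++ [ l + j ] ≈ℕ suc (l + j) ∷ A) (sym split)
    (braid-up (asc j l) (asc o (2 + (l + j))) (l + j) 1≤l+j (asc-< j l) (asc-≥ o _)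
              (subst (All (_≤ M)) split (bounded-by l+k≤ (asc-< (2 + j + o) l))))
    where
    split : asc (2 + j + o) l ≡ asc j l ++ l + j ∷ suc (l + j) ∷ asc o (2 + (l + j))
    split = trans (cong (λ m → asc m l) (sym (trans (+-suc j (suc o)) (cong suc (+-suc j o)))))
                  (asc-+ j (2 + o) l)

  desc-split₂ : ∀ n → desc (2 + n) 0 ≡ desc n 2 ++ 1 ∷ 0 ∷ []
  desc-split₂ n = trans (desc-suc (suc n) 0) (trans (cong (_++ [ 0 ]) (desc-suc n 1)) (++-assoc (desc n 2) [ 1 ] [ 0 ]))

  commute-zero-desc₂ : ∀ n → suc n ≤ M → 0 ∷ desc n 2 ≈ℕ desc n 2 ++ [ 0 ]
  commute-zero-desc₂ n n<M = commute-distant 0 (desc n 2) (All.map inj₁ (desc-≥ n 2)) (bounded-by (s≤s n<M) (desc-< n 2)) z≤n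

  desc-rookL : ∀ n → suc n ≤ M → desc (2 + n) 0 ++ 1 ∷ 0 ∷ [] ≈ℕ 0 ∷ desc (2 + n) 0
  desc-rookL n n<M = subst (λ D → D ++ 1 ∷ 0 ∷ [] ≈ℕ 0 ∷ D) (sym (desc-split₂ n)) (begin
      (X ++ 1 ∷ 0 ∷ []) ++ 1 ∷ 0 ∷ [] ≡⟨ ++-assoc X (1 ∷ 0 ∷ []) (1 ∷ 0 ∷ []) ⟩
      X ++ 1 ∷ 0 ∷ 1 ∷ 0 ∷ []         ≈⟨ ≈ℕ-congˡ X (≈ℕ-rookL (≤-trans (s≤s z≤n) n<M)) ⟩
      X ++ 0 ∷ 1 ∷ 0 ∷ []             ≡⟨ ++-assoc X [ 0 ] (1 ∷ 0 ∷ []) ⟨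
      (X ++ [ 0 ]) ++ 1 ∷ 0 ∷ []      ≈⟨ ≈ℕ-congʳ (1 ∷ 0 ∷ []) (commute-zero-desc₂ n n<M) ⟨
      0 ∷ X ++ 1 ∷ 0 ∷ []             ∎)
    where X = desc n 2

  desc-rookR : ∀ n → suc n ≤ M → 0 ∷ desc (2 + n) 0 ≈ℕ (0 ∷ desc (2 + n) 0) ++ [ 1 ]
  desc-rookR n n<M = subst (λ D → 0 ∷ D ≈ℕ (0 ∷ D) ++ [ 1 ]) (sym (desc-split₂ n)) (begin
      0 ∷ X ++ 1 ∷ 0 ∷ []             ≈⟨ ≈ℕ-congʳ (1 ∷ 0 ∷ []) (commute-zero-desc₂ n n<M) ⟩
      (X ++ [ 0 ]) ++ 1 ∷ 0 ∷ []      ≡⟨ ++-assoc X [ 0 ] (1 ∷ 0 ∷ []) ⟩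
      X ++ 0 ∷ 1 ∷ 0 ∷ []             ≈⟨ ≈ℕ-congˡ X (≈ℕ-rookR (≤-trans (s≤s z≤n) n<M)) ⟩
      X ++ 0 ∷ 1 ∷ 0 ∷ 1 ∷ []         ≡⟨ ++-assoc X [ 0 ] (1 ∷ 0 ∷ 1 ∷ []) ⟨
      (X ++ [ 0 ]) ++ 1 ∷ 0 ∷ 1 ∷ []  ≈⟨ ≈ℕ-congʳ (1 ∷ 0 ∷ 1 ∷ []) (commute-zero-desc₂ n n<M) ⟨
      0 ∷ X ++ 1 ∷ 0 ∷ 1 ∷ []         ≡⟨ cong (0 ∷_) (++-assoc X (1 ∷ 0 ∷ []) [ 1 ]) ⟨
      0 ∷ (X ++ 1 ∷ 0 ∷ []) ++ [ 1 ]  ∎)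
    where X = desc n 2

  desc-lowers-asc : ∀ n q → suc q ≤ n → n ≤ M → desc (suc n) 0 ++ asc q 2 ≈ℕ asc q 1 ++ desc (suc n) 0
  desc-lowers-asc n q q<n n≤M = subst (λ A → D ++ asc q 2 ≈ℕ A ++ D) (map-pred-asc q 1)
      (push-through pred D (asc q 2) (conjugates (asc q 2) (asc-≥ q 2) (asc-< q 2)))
    where
    D = desc (suc n) 0
    conjugates : ∀ W → All (2 ≤_) W → All (_< 2 + q) W → All (λ g → D ++ [ g ] ≈ℕ pred g ∷ D) W
    conjugates []                []               []            = []
    conjugates (suc (suc i) ∷ W) (s≤s (s≤s _) ∷ ≥2) (i<q ∷ W<) =
      desc-lowers (suc n) 0 (suc i) (s≤s z≤n) (s≤s (≤-trans (≤-pred i<q) q<n)) (s≤s n≤M) ∷ conjugates W ≥2 W<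

  asc-raises-asc : ∀ q → suc q ≤ M → asc (suc q) 1 ++ asc q 1 ≈ℕ asc q 2 ++ asc (suc q) 1
  asc-raises-asc q q<M = subst (λ A → asc (suc q) 1 ++ asc q 1 ≈ℕ A ++ asc (suc q) 1) (map-suc-asc q 1)
      (push-through suc (asc (suc q) 1) (asc q 1) (conjugates (asc q 1) (asc-≥ q 1) (asc-< q 1)))
    where
    conjugates : ∀ W → All (1 ≤_) W → All (_< suc q) W → All (λ g → asc (suc q) 1 ++ [ g ] ≈ℕ suc g ∷ asc (suc q) 1) W
    conjugates []          []        []         = []
    conjugates (suc i ∷ W) (s≤s _ ∷ ≥1) (i<q ∷ W<) = asc-raises (suc q) 1 i (s≤s z≤n) i<q (s≤s q<M) ∷ conjugates W ≥1 W<

  placeZero-erase : ∀ n q → suc q ≤ n → n ≤ M → placeZero n (suc q) ++ [ 0 ] ≈ℕ asc (suc q) 0 ++ placeZero n 0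
  placeZero-erase (suc n) q q<n n≤M = begin
      (D ++ 1 ∷ asc q 2) ++ [ 0 ]    ≡⟨ ++-assoc D (1 ∷ asc q 2) [ 0 ] ⟩
      D ++ 1 ∷ asc q 2 ++ [ 0 ]      ≈⟨ ≈ℕ-congˡ D (≈ℕ-congˡ [ 1 ] (commute-distant 0 (asc q 2) (All.map inj₁ (asc-≥ q 2))
                                          (bounded-by (s≤s (≤-trans q<n n≤M)) (asc-< q 2)) z≤n)) ⟨
      D ++ 1 ∷ 0 ∷ asc q 2           ≡⟨ ++-assoc D (1 ∷ 0 ∷ []) (asc q 2) ⟨
      (D ++ 1 ∷ 0 ∷ []) ++ asc q 2   ≈⟨ ≈ℕ-congʳ (asc q 2) (desc-rookL n n≤M) ⟩
      0 ∷ D ++ asc q 2               ≈⟨ ≈ℕ-congˡ [ 0 ] (desc-lowers-asc (suc n) q q<n n≤M) ⟩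
      0 ∷ asc q 1 ++ D               ≡⟨ cong (λ w → 0 ∷ asc q 1 ++ w) (++-identityʳ D) ⟨
      asc (suc q) 0 ++ placeZero (suc n) 0 ∎
    where D = desc (2 + n) 0

  placeZero-absorb₀ : ∀ n → placeZero n 0 ++ [ 0 ] ≈ℕ placeZero n 0
  placeZero-absorb₀ n = ≈ℕ-idem-end (desc n 1) 0 (trans (++-identityʳ _) (desc-suc n 0))

  placeZero-absorb : ∀ n q → placeZero n (suc q) ++ [ suc q ] ≈ℕ placeZero n (suc q)
  placeZero-absorb n q = begin
      (D ++ asc (suc q) 1) ++ [ suc q ] ≡⟨ ++-assoc D (asc (suc q) 1) [ suc q ] ⟩
      D ++ asc (suc q) 1 ++ [ suc q ]   ≈⟨ ≈ℕ-congˡ D (≈ℕ-idem-end (asc q 1) (suc q) (asc-suc q 1)) ⟩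
      D ++ asc (suc q) 1                ∎
    where D = desc (suc n) 0

  placeZero-commuteˡ : ∀ n q i → 2 + i ≤ q → q ≤ n → n ≤ M → placeZero n q ++ [ suc i ] ≈ℕ suc i ∷ placeZero n q
  placeZero-commuteˡ n q i i<q q≤n n≤M = begin
      (D ++ asc q 1) ++ [ suc i ]  ≡⟨ ++-assoc D (asc q 1) [ suc i ] ⟩
      D ++ asc q 1 ++ [ suc i ]    ≈⟨ ≈ℕ-congˡ D (asc-raises q 1 i (s≤s z≤n) i<q (s≤s (≤-trans q≤n n≤M))) ⟩
      D ++ 2 + i ∷ asc q 1         ≡⟨ ++-assoc D [ 2 + i ] (asc q 1) ⟨
      (D ++ [ 2 + i ]) ++ asc q 1  ≈⟨ ≈ℕ-congʳ (asc q 1)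
                                        (desc-lowers (suc n) 0 (suc i) (s≤s z≤n) (s≤s (≤-trans i<q q≤n)) (s≤s n≤M)) ⟩
      suc i ∷ D ++ asc q 1         ∎
    where D = desc (suc n) 0

  placeZero-lowersʳ : ∀ n q i → q ≤ i → 2 + i ≤ n → n ≤ M → placeZero n q ++ [ 2 + i ] ≈ℕ suc i ∷ placeZero n q
  placeZero-lowersʳ n q i q≤i i<n n≤M = begin
      (D ++ asc q 1) ++ [ 2 + i ]  ≡⟨ ++-assoc D (asc q 1) [ 2 + i ] ⟩
      D ++ asc q 1 ++ [ 2 + i ]    ≈⟨ ≈ℕ-congˡ D (commute-distant (2 + i) (asc q 1)
                                        (All.map (λ x<q → inj₂ (s≤s (s≤s (≤-trans (≤-pred x<q) q≤i)))) (asc-< q 1))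
                                        (bounded-by (s≤s (≤-trans q≤i (m+n≤o⇒n≤o 2 (≤-trans i<n n≤M)))) (asc-< q 1))
                                        (≤-trans i<n n≤M)) ⟨
      D ++ 2 + i ∷ asc q 1         ≡⟨ ++-assoc D [ 2 + i ] (asc q 1) ⟨
      (D ++ [ 2 + i ]) ++ asc q 1  ≈⟨ ≈ℕ-congʳ (asc q 1) (desc-lowers (suc n) 0 (suc i) (s≤s z≤n) (s≤s i<n) (s≤s n≤M)) ⟩
      suc i ∷ D ++ asc q 1         ∎
    where D = desc (suc n) 0

  placeZero-absorbNext : ∀ n q → suc q ≤ n → n ≤ M →
    (asc (suc q) 0 ++ placeZero n q) ++ [ suc q ] ≈ℕ asc (suc q) 0 ++ placeZero n q
  placeZero-absorbNext (suc n) q q<n n≤M = begin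
      S ++ [ suc q ]                   ≈⟨ ≈ℕ-congʳ [ suc q ] rearranged ⟩
      (Z ++ U₁ ++ U₀) ++ [ suc q ]     ≡⟨ ++-assoc Z (U₁ ++ U₀) [ suc q ] ⟩
      Z ++ (U₁ ++ U₀) ++ [ suc q ]     ≈⟨ ≈ℕ-congˡ Z (≈ℕ-congʳ [ suc q ] (asc-raises-asc q q<M)) ⟩
      Z ++ (U₂ ++ U₁) ++ [ suc q ]     ≡⟨ cong (Z ++_) (++-assoc U₂ U₁ [ suc q ]) ⟩
      Z ++ U₂ ++ U₁ ++ [ suc q ]       ≈⟨ ≈ℕ-congˡ Z (≈ℕ-congˡ U₂ (≈ℕ-idem-end (asc q 1) (suc q) (asc-suc q 1))) ⟩
      Z ++ U₂ ++ U₁                    ≈⟨ ≈ℕ-congˡ Z (asc-raises-asc q q<M) ⟨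
      Z ++ U₁ ++ U₀                    ≈⟨ rearranged ⟨
      S                                ∎
    where
    D  = desc (2 + n) 0
    Z  = 0 ∷ D
    U₀ = asc q 1
    U₁ = asc (suc q) 1
    U₂ = asc q 2
    S  = asc (suc q) 0 ++ placeZero (suc n) q
    q<M = ≤-trans q<n n≤M
    rearranged : S ≈ℕ Z ++ U₁ ++ U₀
    rearranged = begin
      0 ∷ U₀ ++ D ++ U₀         ≡⟨ cong (0 ∷_) (++-assoc U₀ D U₀) ⟨
      0 ∷ (U₀ ++ D) ++ U₀       ≈⟨ ≈ℕ-congˡ [ 0 ] (≈ℕ-congʳ U₀ (desc-lowers-asc (suc n) q q<n n≤M)) ⟨
      0 ∷ (D ++ U₂) ++ U₀       ≡⟨ cong (0 ∷_) (++-assoc D U₂ U₀) ⟩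
      Z ++ U₂ ++ U₀             ≈⟨ ≈ℕ-congʳ (U₂ ++ U₀) (desc-rookR n n≤M) ⟩
      (Z ++ [ 1 ]) ++ U₂ ++ U₀  ≡⟨ ++-assoc Z [ 1 ] (U₂ ++ U₀) ⟩
      Z ++ U₁ ++ U₀             ∎

-- The normal form absorbs the action

absorbs-max-erase : ∀ n b → IsRookList n b → normalForm (suc n) (suc n ∷ b) ++ [ 0 ] ≡ normalForm (suc n) (0 ∷ b)
absorbs-max-erase n b rk = begin
    normalForm (suc n) (suc n ∷ b) ++ [ 0 ]        ≡⟨ cong (_++ [ 0 ]) (normalForm-withMax n [] b []) ⟩
    (normalForm n b ++ desc (length b) 1) ++ [ 0 ] ≡⟨ ++-assoc (normalForm n b) (desc (length b) 1) [ 0 ] ⟩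
    normalForm n b ++ desc (length b) 1 ++ [ 0 ]   ≡⟨ cong (normalForm n b ++_) (desc-suc (length b) 0) ⟨
    normalForm n b ++ desc (suc (length b)) 0      ≡⟨ cong (λ m → normalForm n b ++ desc (suc m) 0) (IsRookList.length≡ rk) ⟩
    normalForm n b ++ desc (suc n) 0               ≡⟨ cong (normalForm n b ++_) (++-identityʳ _) ⟨
    normalForm n b ++ placeZero n 0                ≡⟨ normalForm-withoutMax n [] b ((λ ()) ∷ b≢n) [] ⟨
    normalForm (suc n) (0 ∷ b)                     ∎
  where
  open ≡-Reasoning
  b≢n = All.map (λ x≤n → <⇒≢ (s≤s x≤n)) (IsRookList.bounded rk)

absorbs-max-rise : ∀ n a x b → All (_≢ suc n) (a ++ [ x ]) → IsRookList n ((a ++ [ x ]) ++ b) →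
  normalForm (suc n) ((a ++ [ x ]) ++ suc n ∷ b) ++ [ suc (length a) ] ≡
  normalForm (suc n) (actGenℕ ((a ++ [ x ]) ++ suc n ∷ b) (suc (length a)))
absorbs-max-rise n a x b ax≢ rk = begin
    normalForm (suc n) ((a ++ [ x ]) ++ suc n ∷ b) ++ [ suc (length a) ]
  ≡⟨ cong (_++ [ suc (length a) ]) (normalForm-withMax n (a ++ [ x ]) b ax≢) ⟩
    (normalForm n ((a ++ [ x ]) ++ b) ++ desc (length b) (suc (length (a ++ [ x ])))) ++ [ suc (length a) ]
  ≡⟨ cong₂ (λ t m → (normalForm n t ++ desc (length b) (suc m)) ++ [ suc (length a) ]) (++-assoc a [ x ] b) (length-snoc a x) ⟩
    (normalForm n (a ++ x ∷ b) ++ desc (length b) (2 + length a)) ++ [ suc (length a) ]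
  ≡⟨ ++-assoc (normalForm n (a ++ x ∷ b)) _ [ suc (length a) ] ⟩
    normalForm n (a ++ x ∷ b) ++ desc (length b) (2 + length a) ++ [ suc (length a) ]
  ≡⟨ cong (normalForm n (a ++ x ∷ b) ++_) (desc-suc (length b) (suc (length a))) ⟨
    normalForm n (a ++ x ∷ b) ++ desc (suc (length b)) (suc (length a))
  ≡⟨ normalForm-withMax n a (x ∷ b) (++⁻ˡ a ax≢) ⟨
    normalForm (suc n) (a ++ suc n ∷ x ∷ b)
  ≡⟨ cong (normalForm (suc n)) (swapAt-rise a b (s≤s x≤n)) ⟨
    normalForm (suc n) (swapAt (length a) (a ++ x ∷ suc n ∷ b))
  ≡⟨ cong (normalForm (suc n) ∘ swapAt (length a)) (++-assoc a [ x ] (suc n ∷ b)) ⟨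
    normalForm (suc n) (actGenℕ ((a ++ [ x ]) ++ suc n ∷ b) (suc (length a)))
  ∎
  where
  open ≡-Reasoning
  x≤n = All.head (++⁻ʳ a (++⁻ˡ (a ++ [ x ]) (IsRookList.bounded rk)))

absorbs-zero-rise : ∀ n a y b → All (_≢ suc n) (a ++ 0 ∷ suc y ∷ b) → All (_≢ 0) a →
  normalForm (suc n) (a ++ 0 ∷ suc y ∷ b) ++ [ suc (length a) ] ≡
  normalForm (suc n) (actGenℕ (a ++ 0 ∷ suc y ∷ b) (suc (length a)))
absorbs-zero-rise n a y b s≢n a≢0 = begin
    normalForm (suc n) (a ++ 0 ∷ suc y ∷ b) ++ [ suc (length a) ]
  ≡⟨ cong (_++ [ suc (length a) ]) (normalForm-withoutMax n a (suc y ∷ b) s≢n a≢0) ⟩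
    (C ++ desc (suc n) 0 ++ asc (length a) 1) ++ [ suc (length a) ]
  ≡⟨ trans (++-assoc C _ [ suc (length a) ]) (cong (C ++_) (++-assoc (desc (suc n) 0) (asc (length a) 1) _)) ⟩
    C ++ desc (suc n) 0 ++ asc (length a) 1 ++ [ suc (length a) ]
  ≡⟨ cong (λ w → C ++ desc (suc n) 0 ++ w) (asc-suc (length a) 1) ⟨
    C ++ placeZero n (suc (length a))
  ≡⟨ cong₂ (λ t m → normalForm n t ++ placeZero n m) (++-assoc a [ suc y ] b) (length-snoc a (suc y)) ⟨
    normalForm n ((a ++ [ suc y ]) ++ b) ++ placeZero n (length (a ++ [ suc y ]))
  ≡⟨ normalForm-withoutMax n (a ++ [ suc y ]) b (subst (All (_≢ suc n)) acted (All-actGenℕ (λ ()) _ (suc (length a)) s≢n))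
                                                (++⁺ a≢0 ((λ ()) ∷ [])) ⟨
    normalForm (suc n) ((a ++ [ suc y ]) ++ 0 ∷ b)
  ≡⟨ cong (normalForm (suc n)) acted ⟨
    normalForm (suc n) (actGenℕ (a ++ 0 ∷ suc y ∷ b) (suc (length a)))
  ∎
  where
  open ≡-Reasoning
  C = normalForm n (a ++ suc y ∷ b)
  acted : actGenℕ (a ++ 0 ∷ suc y ∷ b) (suc (length a)) ≡ (a ++ [ suc y ]) ++ 0 ∷ b
  acted = trans (swapAt-rise a b (s≤s z≤n)) (sym (++-assoc a [ suc y ] (0 ∷ b)))

module NormalFormLaw (M : ℕ) where

  open WordCongruence M

  NormalFormAbsorbs : ℕ → Set
  NormalFormAbsorbs n = ∀ t → IsRookList n t → ∀ w → All (_< n) w → normalForm n t ++ w ≈ℕ normalForm n (t ·ℕ w)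

  module _ {n} (n≤M : n ≤ M) (absorbs : NormalFormAbsorbs n) where

    private
      absorbs₁ : ∀ t → IsRookList n t → ∀ g → g < n → normalForm n t ++ [ g ] ≈ℕ normalForm n (actGenℕ t g)
      absorbs₁ t rk g g<n = absorbs t rk [ g ] (g<n ∷ [])

      desc-bounded : ∀ a b → IsRookList n (a ++ b) → All (_≤ M) (desc (length b) (suc (length a)))
      desc-bounded a b rk = bounded-by (s≤s n≤M)
        (subst (λ m → All (_< m) (desc (length b) (suc (length a)))) (cong suc (lengths-sum a b rk))
               (desc-< (length b) (suc (length a))))

    absorbs-max-left : ∀ a b → All (_≢ suc n) a → IsRookList n (a ++ b) → ∀ g → g < length a →
      normalForm (suc n) (a ++ suc n ∷ b) ++ [ g ] ≈ℕ normalForm (suc n) (actGenℕ (a ++ suc n ∷ b) g)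
    absorbs-max-left a b a≢ rk g g<a = begin
        normalForm (suc n) (a ++ suc n ∷ b) ++ [ g ] ≡⟨ cong (_++ [ g ]) (normalForm-withMax n a b a≢) ⟩
        (C ++ D) ++ [ g ]                  ≡⟨ ++-assoc C D [ g ] ⟩
        C ++ D ++ [ g ]                    ≈⟨ ≈ℕ-congˡ C (commute-distant g D distant (desc-bounded a b rk) g≤M) ⟨
        C ++ g ∷ D                         ≡⟨ ++-assoc C [ g ] D ⟨
        (C ++ [ g ]) ++ D                  ≈⟨ ≈ℕ-congʳ D (absorbs₁ (a ++ b) rk g g<n) ⟩
        normalForm n (actGenℕ (a ++ b) g) ++ D
          ≡⟨ cong₂ (λ t m → normalForm n t ++ desc (length b) (suc m)) (actGenℕ-++ˡ g a b g<a) (sym (length-actGenℕ a g)) ⟩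
        normalForm n (actGenℕ a g ++ b) ++ desc (length b) (suc (length (actGenℕ a g)))
          ≡⟨ normalForm-withMax n (actGenℕ a g) b (All-actGenℕ (λ ()) a g a≢) ⟨
        normalForm (suc n) (actGenℕ a g ++ suc n ∷ b)
          ≡⟨ cong (normalForm (suc n)) (actGenℕ-++ˡ g a (suc n ∷ b) g<a) ⟨
        normalForm (suc n) (actGenℕ (a ++ suc n ∷ b) g) ∎
      where
      C = normalForm n (a ++ b)
      D = desc (length b) (suc (length a))
      g<n = <-≤-trans g<a (prefix-length≤ a b rk)
      g≤M = ≤-trans (<⇒≤ g<n) n≤M
      distant : All (Distant g) D
      distant = All.map (λ a<x → inj₁ (≤-trans (s≤s g<a) a<x)) (desc-≥ (length b) (suc (length a)))

    absorbs-max-fixed : ∀ a y b → All (_≢ suc n) a → IsRookList n (a ++ y ∷ b) →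
      normalForm (suc n) (a ++ suc n ∷ y ∷ b) ++ [ suc (length a) ] ≈ℕ
      normalForm (suc n) (actGenℕ (a ++ suc n ∷ y ∷ b) (suc (length a)))
    absorbs-max-fixed a y b a≢ rk = begin
        normalForm (suc n) (a ++ suc n ∷ y ∷ b) ++ [ suc (length a) ]
          ≡⟨ cong (_++ [ suc (length a) ]) (normalForm-withMax n a (y ∷ b) a≢) ⟩
        (C ++ D) ++ [ suc (length a) ]  ≡⟨ ++-assoc C D [ suc (length a) ] ⟩
        C ++ D ++ [ suc (length a) ]    ≈⟨ ≈ℕ-congˡ C (≈ℕ-idem-end (desc (length b) (2 + length a)) (suc (length a))
                                                                  (desc-suc (length b) (suc (length a)))) ⟩
        C ++ D                          ≡⟨ normalForm-withMax n a (y ∷ b) a≢ ⟨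
        normalForm (suc n) (a ++ suc n ∷ y ∷ b)
          ≡⟨ cong (normalForm (suc n)) (swapAt-fixed a b (≤-trans y≤n (n≤1+n n))) ⟨
        normalForm (suc n) (actGenℕ (a ++ suc n ∷ y ∷ b) (suc (length a))) ∎
      where
      C = normalForm n (a ++ y ∷ b)
      D = desc (suc (length b)) (suc (length a))
      y≤n = All.head (++⁻ʳ a (IsRookList.bounded rk))

    absorbs-max-right : ∀ a b → All (_≢ suc n) a → IsRookList n (a ++ b) → ∀ j → suc (length a + suc j) ≤ n →
      normalForm (suc n) (a ++ suc n ∷ b) ++ [ suc (length a + suc j) ] ≈ℕ
      normalForm (suc n) (actGenℕ (a ++ suc n ∷ b) (suc (length a + suc j)))
    absorbs-max-right a b a≢ rk j g≤n = begin
        normalForm (suc n) (a ++ suc n ∷ b) ++ [ g ] ≡⟨ cong (_++ [ g ]) (normalForm-withMax n a b a≢) ⟩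
        (C ++ D) ++ [ g ]             ≡⟨ ++-assoc C D [ g ] ⟩
        C ++ D ++ [ g ]               ≈⟨ ≈ℕ-congˡ C conj ⟩
        C ++ P + suc j ∷ D            ≡⟨ ++-assoc C [ P + suc j ] D ⟨
        (C ++ [ P + suc j ]) ++ D     ≈⟨ ≈ℕ-congʳ D (absorbs₁ (a ++ b) rk (P + suc j) g≤n) ⟩
        normalForm n (actGenℕ (a ++ b) (P + suc j)) ++ D
          ≡⟨ cong₂ (λ t m → normalForm n t ++ desc m (suc P)) acted (sym (length-swapAt j b)) ⟩
        normalForm n (a ++ swapAt j b) ++ desc (length (swapAt j b)) (suc P)
          ≡⟨ normalForm-withMax n a (swapAt j b) a≢ ⟨
        normalForm (suc n) (a ++ suc n ∷ swapAt j b)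
          ≡⟨ cong (normalForm (suc n)) (swapAt-++ʳ a (suc j) (suc n ∷ b)) ⟨
        normalForm (suc n) (actGenℕ (a ++ suc n ∷ b) g) ∎
      where
      P = length a
      g = suc (P + suc j)
      C = normalForm n (a ++ b)
      D = desc (length b) (suc P)
      acted : actGenℕ (a ++ b) (P + suc j) ≡ a ++ swapAt j b
      acted = trans (cong (actGenℕ (a ++ b)) (+-suc P j)) (swapAt-++ʳ a j b)
      j<b : 2 + j ≤ length b
      j<b = +-cancelˡ-≤ P (2 + j) (length b) (subst₂ _≤_ (sym (+-suc P (suc j))) (sym (lengths-sum a b rk)) g≤n)
      conj : D ++ [ g ] ≈ℕ P + suc j ∷ D
      conj = subst (λ c → D ++ [ suc c ] ≈ℕ c ∷ D) (sym (+-suc P j))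
               (desc-lowers (length b) (suc P) j (s≤s z≤n) j<b (s≤s (subst (_≤ M) (sym (lengths-sum a b rk)) n≤M)))


    absorbs-zero-left : ∀ a b → All (_≢ suc n) (a ++ 0 ∷ b) → All (_≢ 0) a → IsRookList n (a ++ b) →
      ∀ i → 2 + i ≤ length a →
      normalForm (suc n) (a ++ 0 ∷ b) ++ [ suc i ] ≈ℕ normalForm (suc n) (actGenℕ (a ++ 0 ∷ b) (suc i))
    absorbs-zero-left a b s≢n a≢0 rk i i<a = begin
        normalForm (suc n) (a ++ 0 ∷ b) ++ [ suc i ] ≡⟨ cong (_++ [ suc i ]) (normalForm-withoutMax n a b s≢n a≢0) ⟩
        (C ++ Z) ++ [ suc i ]            ≡⟨ ++-assoc C Z [ suc i ] ⟩
        C ++ Z ++ [ suc i ]              ≈⟨ ≈ℕ-congˡ C (placeZero-commuteˡ n (length a) i i<a (prefix-length≤ a b rk) n≤M) ⟩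
        C ++ suc i ∷ Z                   ≡⟨ ++-assoc C [ suc i ] Z ⟨
        (C ++ [ suc i ]) ++ Z            ≈⟨ ≈ℕ-congʳ Z (absorbs₁ (a ++ b) rk (suc i) (<-≤-trans i<a (prefix-length≤ a b rk))) ⟩
        normalForm n (swapAt i (a ++ b)) ++ Z
          ≡⟨ cong₂ (λ t m → normalForm n t ++ placeZero n m) (swapAt-++ˡ i a b i<a) (sym (length-swapAt i a)) ⟩
        normalForm n (swapAt i a ++ b) ++ placeZero n (length (swapAt i a))
          ≡⟨ normalForm-withoutMax n (swapAt i a) b (subst (All (_≢ suc n)) acted (All-actGenℕ (λ ()) _ (suc i) s≢n))
                                                    (All-swapAt i a a≢0) ⟨
        normalForm (suc n) (swapAt i a ++ 0 ∷ b) ≡⟨ cong (normalForm (suc n)) acted ⟨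
        normalForm (suc n) (actGenℕ (a ++ 0 ∷ b) (suc i)) ∎
      where
      C = normalForm n (a ++ b)
      Z = placeZero n (length a)
      acted : actGenℕ (a ++ 0 ∷ b) (suc i) ≡ swapAt i a ++ 0 ∷ b
      acted = swapAt-++ˡ i a (0 ∷ b) i<a

    absorbs-zero-erase : ∀ y a b → All (_≢ suc n) (y ∷ a ++ 0 ∷ b) → All (_≢ 0) (y ∷ a) → IsRookList n (y ∷ a ++ b) →
      normalForm (suc n) (y ∷ a ++ 0 ∷ b) ++ [ 0 ] ≈ℕ normalForm (suc n) (0 ∷ a ++ 0 ∷ b)
    absorbs-zero-erase y a b s≢n a≢0 rk = begin
        normalForm (suc n) (y ∷ a ++ 0 ∷ b) ++ [ 0 ]
          ≡⟨ cong (_++ [ 0 ]) (normalForm-withoutMax n (y ∷ a) b s≢n a≢0) ⟩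
        (C ++ placeZero n (suc (length a))) ++ [ 0 ]      ≡⟨ ++-assoc C (placeZero n (suc (length a))) [ 0 ] ⟩
        C ++ placeZero n (suc (length a)) ++ [ 0 ]        ≈⟨ ≈ℕ-congˡ C (placeZero-erase n (length a) a<n n≤M) ⟩
        C ++ asc (suc (length a)) 0 ++ placeZero n 0      ≡⟨ ++-assoc C (asc (suc (length a)) 0) (placeZero n 0) ⟨
        (C ++ asc (suc (length a)) 0) ++ placeZero n 0
          ≈⟨ ≈ℕ-congʳ (placeZero n 0) (absorbs (y ∷ a ++ b) rk (asc (suc (length a)) 0)
                                               (All.map (λ p → ≤-trans p a<n) (asc-< (suc (length a)) 0))) ⟩
        normalForm n ((0 ∷ a ++ b) ·ℕ asc (length a) 1) ++ placeZero n 0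
          ≡⟨ cong (λ t → normalForm n t ++ placeZero n 0) (asc-moveZero [] a b (All.tail a≢0)) ⟩
        normalForm n (a ++ 0 ∷ b) ++ placeZero n 0        ≡⟨ normalForm-withoutMax n [] (a ++ 0 ∷ b) ((λ ()) ∷ All.tail s≢n) [] ⟨
        normalForm (suc n) (0 ∷ a ++ 0 ∷ b)               ∎
      where
      C = normalForm n (y ∷ a ++ b)
      a<n = prefix-length≤ (y ∷ a) b rk

    absorbs-zero-erase₀ : ∀ b → All (_≢ suc n) (0 ∷ b) →
      normalForm (suc n) (0 ∷ b) ++ [ 0 ] ≈ℕ normalForm (suc n) (0 ∷ b)
    absorbs-zero-erase₀ b s≢n = begin
        normalForm (suc n) (0 ∷ b) ++ [ 0 ]      ≡⟨ cong (_++ [ 0 ]) (normalForm-withoutMax n [] b s≢n []) ⟩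
        (C ++ placeZero n 0) ++ [ 0 ]            ≡⟨ ++-assoc C (placeZero n 0) [ 0 ] ⟩
        C ++ placeZero n 0 ++ [ 0 ]              ≈⟨ ≈ℕ-congˡ C (placeZero-absorb₀ n) ⟩
        C ++ placeZero n 0                       ≡⟨ normalForm-withoutMax n [] b s≢n [] ⟨
        normalForm (suc n) (0 ∷ b)               ∎
      where C = normalForm n b

    absorbs-zero-fixed : ∀ a x b → All (_≢ suc n) ((a ++ [ x ]) ++ 0 ∷ b) → All (_≢ 0) (a ++ [ x ]) →
      normalForm (suc n) ((a ++ [ x ]) ++ 0 ∷ b) ++ [ suc (length a) ] ≈ℕ
      normalForm (suc n) (actGenℕ ((a ++ [ x ]) ++ 0 ∷ b) (suc (length a)))
    absorbs-zero-fixed a x b s≢n a≢0 = begin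
        normalForm (suc n) s ++ [ suc (length a) ]
          ≡⟨ cong (_++ [ suc (length a) ]) (normalForm-withoutMax n (a ++ [ x ]) b s≢n a≢0) ⟩
        (C ++ placeZero n (length (a ++ [ x ]))) ++ [ suc (length a) ]
          ≡⟨ trans (cong (λ m → (C ++ placeZero n m) ++ [ suc (length a) ]) (length-snoc a x))
                   (++-assoc C (placeZero n (suc (length a))) [ suc (length a) ]) ⟩
        C ++ placeZero n (suc (length a)) ++ [ suc (length a) ]  ≈⟨ ≈ℕ-congˡ C (placeZero-absorb n (length a)) ⟩
        C ++ placeZero n (suc (length a))   ≡⟨ cong (λ m → C ++ placeZero n m) (length-snoc a x) ⟨
        C ++ placeZero n (length (a ++ [ x ]))  ≡⟨ normalForm-withoutMax n (a ++ [ x ]) b s≢n a≢0 ⟨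
        normalForm (suc n) s                ≡⟨ cong (normalForm (suc n)) fixed ⟨
        normalForm (suc n) (actGenℕ s (suc (length a))) ∎
      where
      s = (a ++ [ x ]) ++ 0 ∷ b
      C = normalForm n ((a ++ [ x ]) ++ b)
      fixed : actGenℕ s (suc (length a)) ≡ s
      fixed = trans (cong (swapAt (length a)) (++-assoc a [ x ] (0 ∷ b)))
                    (trans (swapAt-fixed a b z≤n) (sym (++-assoc a [ x ] (0 ∷ b))))

    -- Writing a 0 b as (0 a b) · P splits P off its normal form, and P absorbs the generator.
    absorbs-zero-twoZeros : ∀ a b → All (_≢ suc n) (a ++ 0 ∷ 0 ∷ b) → All (_≢ 0) a → IsRookList n (a ++ 0 ∷ b) →
      normalForm (suc n) (a ++ 0 ∷ 0 ∷ b) ++ [ suc (length a) ] ≈ℕ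
      normalForm (suc n) (actGenℕ (a ++ 0 ∷ 0 ∷ b) (suc (length a)))
    absorbs-zero-twoZeros a b s≢n a≢0 rk = begin
        normalForm (suc n) s ++ [ suc (length a) ]     ≡⟨ cong (_++ [ suc (length a) ]) (normalForm-withoutMax n a (0 ∷ b) s≢n a≢0) ⟩
        (C ++ Z) ++ [ suc (length a) ]                 ≡⟨ cong (λ t → (normalForm n t ++ Z) ++ [ suc (length a) ]) moved ⟨
        (normalForm n (t ·ℕ P) ++ Z) ++ [ suc (length a) ]
          ≈⟨ ≈ℕ-congʳ [ suc (length a) ] (≈ℕ-congʳ Z (absorbs t rk-t P P<n)) ⟨
        ((normalForm n t ++ P) ++ Z) ++ [ suc (length a) ]
          ≡⟨ trans (++-assoc (normalForm n t ++ P) Z _) (++-assoc (normalForm n t) P (Z ++ _)) ⟩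
        normalForm n t ++ P ++ Z ++ [ suc (length a) ] ≡⟨ cong (normalForm n t ++_) (++-assoc P Z _) ⟨
        normalForm n t ++ (P ++ Z) ++ [ suc (length a) ]
          ≈⟨ ≈ℕ-congˡ (normalForm n t) (placeZero-absorbNext n (length a) a<n n≤M) ⟩
        normalForm n t ++ P ++ Z                       ≡⟨ ++-assoc (normalForm n t) P Z ⟨
        (normalForm n t ++ P) ++ Z                     ≈⟨ ≈ℕ-congʳ Z (absorbs t rk-t P P<n) ⟩
        normalForm n (t ·ℕ P) ++ Z                     ≡⟨ cong (λ t → normalForm n t ++ Z) moved ⟩
        C ++ Z                                         ≡⟨ normalForm-withoutMax n a (0 ∷ b) s≢n a≢0 ⟨
        normalForm (suc n) s                           ≡⟨ cong (normalForm (suc n)) (swapAt-fixed a b z≤n) ⟨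
        normalForm (suc n) (actGenℕ s (suc (length a))) ∎
      where
      s = a ++ 0 ∷ 0 ∷ b
      C = normalForm n (a ++ 0 ∷ b)
      Z = placeZero n (length a)
      t = 0 ∷ a ++ b
      P = asc (suc (length a)) 0
      moved : t ·ℕ P ≡ a ++ 0 ∷ b
      moved = asc-moveZero [] a b a≢0
      rk-t : IsRookList n t
      rk-t = IsRookList-zeroToFront a b rk
      a<n : suc (length a) ≤ n
      a<n = prefix-length≤ (0 ∷ a) b rk-t
      P<n : All (_< n) P
      P<n = All.map (λ p → ≤-trans p a<n) (asc-< (suc (length a)) 0)

    absorbs-zero-right : ∀ a b → All (_≢ suc n) (a ++ 0 ∷ b) → All (_≢ 0) a → IsRookList n (a ++ b) →
      ∀ j → suc (length a + suc j) ≤ n →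
      normalForm (suc n) (a ++ 0 ∷ b) ++ [ suc (length a + suc j) ] ≈ℕ
      normalForm (suc n) (actGenℕ (a ++ 0 ∷ b) (suc (length a + suc j)))
    absorbs-zero-right a b s≢n a≢0 rk j g≤n = begin
        normalForm (suc n) (a ++ 0 ∷ b) ++ [ g ] ≡⟨ cong (_++ [ g ]) (normalForm-withoutMax n a b s≢n a≢0) ⟩
        (C ++ Z) ++ [ g ]                ≡⟨ ++-assoc C Z [ g ] ⟩
        C ++ Z ++ [ g ]                  ≈⟨ ≈ℕ-congˡ C conj ⟩
        C ++ P + suc j ∷ Z               ≡⟨ ++-assoc C [ P + suc j ] Z ⟨
        (C ++ [ P + suc j ]) ++ Z        ≈⟨ ≈ℕ-congʳ Z (absorbs₁ (a ++ b) rk (P + suc j) g≤n) ⟩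
        normalForm n (actGenℕ (a ++ b) (P + suc j)) ++ Z
          ≡⟨ cong (λ t → normalForm n t ++ Z) (trans (cong (actGenℕ (a ++ b)) (+-suc P j)) (swapAt-++ʳ a j b)) ⟩
        normalForm n (a ++ swapAt j b) ++ Z
          ≡⟨ normalForm-withoutMax n a (swapAt j b) (subst (All (_≢ suc n)) acted (All-actGenℕ (λ ()) _ g s≢n)) a≢0 ⟨
        normalForm (suc n) (a ++ 0 ∷ swapAt j b) ≡⟨ cong (normalForm (suc n)) acted ⟨
        normalForm (suc n) (actGenℕ (a ++ 0 ∷ b) g) ∎
      where
      P = length a
      g = suc (P + suc j)
      C = normalForm n (a ++ b)
      Z = placeZero n P
      acted : actGenℕ (a ++ 0 ∷ b) g ≡ a ++ 0 ∷ swapAt j b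
      acted = swapAt-++ʳ a (suc j) (0 ∷ b)
      conj : Z ++ [ g ] ≈ℕ P + suc j ∷ Z
      conj = subst₂ (λ u v → Z ++ [ u ] ≈ℕ v ∷ Z) (cong suc (sym (+-suc P j))) (sym (+-suc P j))
               (placeZero-lowersʳ n P (P + j) (m≤m+n P j) (subst (_≤ n) (cong suc (+-suc P j)) g≤n) n≤M)

    absorbs-max : ∀ a b → All (_≢ suc n) a → IsRookList n (a ++ b) → ∀ g → g ≤ n →
      normalForm (suc n) (a ++ suc n ∷ b) ++ [ g ] ≈ℕ normalForm (suc n) (actGenℕ (a ++ suc n ∷ b) g)
    absorbs-max a b a≢ rk g g≤n with <-cmp g (length a)
    ... | tri< g<a _ _ = absorbs-max-left a b a≢ rk g g<a
    ... | tri≈ _ refl _ with initLast a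
    ...   | []       = ≈ℕ-reflexive (absorbs-max-erase n b rk)
    ...   | a′ ∷ʳ′ x rewrite length-snoc a′ x = ≈ℕ-reflexive (absorbs-max-rise n a′ x b a≢ rk)
    absorbs-max a b a≢ rk g g≤n | tri> _ _ a<g with m≤n⇒∃[o]m+o≡n a<g
    ... | suc j , refl = absorbs-max-right a b a≢ rk j g≤n
    ... | zero  , refl with b
    ...   | []    = ⊥-elim (1+n≰n (subst (suc (length a + 0) ≤_) (sym (lengths-sum a [] rk)) g≤n))
    ...   | y ∷ b′ rewrite +-identityʳ (length a) = absorbs-max-fixed a y b′ a≢ rk

    absorbs-zero : ∀ a b → All (_≢ suc n) (a ++ 0 ∷ b) → All (_≢ 0) a → IsRookList n (a ++ b) → ∀ g → g ≤ n →
      normalForm (suc n) (a ++ 0 ∷ b) ++ [ g ] ≈ℕ normalForm (suc n) (actGenℕ (a ++ 0 ∷ b) g)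
    absorbs-zero a b s≢n a≢0 rk g g≤n with <-cmp g (length a)
    absorbs-zero (y ∷ a) b s≢n a≢0 rk zero g≤n | tri< _ _ _ = absorbs-zero-erase y a b s≢n a≢0 rk
    absorbs-zero a b s≢n a≢0 rk (suc i) g≤n | tri< i<a _ _ = absorbs-zero-left a b s≢n a≢0 rk i i<a
    ... | tri≈ _ refl _ with initLast a
    ...   | []       = absorbs-zero-erase₀ b s≢n
    ...   | a′ ∷ʳ′ x rewrite length-snoc a′ x = absorbs-zero-fixed a′ x b s≢n a≢0
    absorbs-zero a b s≢n a≢0 rk g g≤n | tri> _ _ a<g with m≤n⇒∃[o]m+o≡n a<g
    ... | suc j , refl = absorbs-zero-right a b s≢n a≢0 rk j g≤n
    ... | zero  , refl with b
    ...   | []         = ⊥-elim (1+n≰n (subst (suc (length a + 0) ≤_) (sym (lengths-sum a [] rk)) g≤n))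
    ...   | zero ∷ b′  rewrite +-identityʳ (length a) = absorbs-zero-twoZeros a b′ s≢n a≢0 rk
    ...   | suc y ∷ b′ rewrite +-identityʳ (length a) = ≈ℕ-reflexive (absorbs-zero-rise n a y b′ s≢n a≢0)

    absorbs-step : ∀ s → IsRookList (suc n) s → ∀ g → g ≤ n →
      normalForm (suc n) s ++ [ g ] ≈ℕ normalForm (suc n) (actGenℕ s g)
    absorbs-step s rk with shape n s rk
    ... | withMax a b a≢ rk′           = absorbs-max a b a≢ rk′
    ... | withoutMax a b s≢n a≢0 rk′   = absorbs-zero a b s≢n a≢0 rk′

    absorbs-suc : NormalFormAbsorbs (suc n)
    absorbs-suc t rk []      []          = ≈ℕ-reflexive (++-identityʳ _)
    absorbs-suc t rk (g ∷ w) (g<n ∷ w<n) = begin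
        normalForm (suc n) t ++ g ∷ w            ≡⟨ ++-assoc (normalForm (suc n) t) [ g ] w ⟨
        (normalForm (suc n) t ++ [ g ]) ++ w     ≈⟨ ≈ℕ-congʳ w (absorbs-step t rk g (≤-pred g<n)) ⟩
        normalForm (suc n) (actGenℕ t g) ++ w    ≈⟨ absorbs-suc (actGenℕ t g) (IsRookList-actGenℕ g rk) w w<n ⟩
        normalForm (suc n) (actGenℕ t g ·ℕ w)    ∎

  normalForm-absorbs : ∀ n → n ≤ suc M → NormalFormAbsorbs n
  normalForm-absorbs zero    _   t _ [] [] = ≈ℕ-refl
  normalForm-absorbs (suc n) n≤M = absorbs-suc (≤-pred n≤M) (normalForm-absorbs n (≤-trans (n≤1+n n) n≤M))

-- Back to vectors

toℕs : ∀ {K k} → Vec (Fin K) k → List ℕ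
toℕs v = toList (V.map toℕ v)

toℕs-injective : ∀ {K k} (u v : Vec (Fin K) k) → toℕs u ≡ toℕs v → u ≡ v
toℕs-injective V.[]       V.[]       _  = refl
toℕs-injective (x V.∷ u) (y V.∷ v) eq =
  cong₂ V._∷_ (toℕ-injective (∷-injectiveˡ eq)) (toℕs-injective u v (∷-injectiveʳ eq))

-- Defs.swapIfLess at an arbitrary length, so that it can be unfolded along a vector.
swapIfLessᵛ : ∀ {K k} → Vec (Fin K) k → Fin k → Fin k → Vec (Fin K) k
swapIfLessᵛ r i j =
  if does (lookup r i F.<? lookup r j)
  then (r [ i ]≔ lookup r j) [ j ]≔ lookup r i
  else r

toℕs-swapIfLess : ∀ {K k} (r : Vec (Fin K) (suc k)) (i : Fin k) →
  toℕs (swapIfLessᵛ r (inject₁ i) (F.suc i)) ≡ swapAt (toℕ i) (toℕs r)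
toℕs-swapIfLess (x V.∷ y V.∷ r) F.zero with does (toℕ x <? toℕ y)
... | true  = refl
... | false = refl
toℕs-swapIfLess (x V.∷ r) (F.suc i) with does (lookup r (inject₁ i) F.<? lookup r (F.suc i))
                                      | toℕs-swapIfLess r i
... | true  | eq = cong (toℕ x ∷_) eq
... | false | eq = cong (toℕ x ∷_) eq

toℕs-actGen : ∀ {n} (r : Word n) (g : Fin n) → toℕs (actGen r g) ≡ actGenℕ (toℕs r) (toℕ g)
toℕs-actGen {suc m} (x V.∷ r) F.zero    = refl
toℕs-actGen {suc m} r         (F.suc k) = toℕs-swapIfLess r k

toℕs-· : ∀ {n} (r : Word n) (w : GWord n) → toℕs (r · w) ≡ toℕs r ·ℕ map toℕ w
toℕs-· r []      = refl
toℕs-· r (g ∷ w) = trans (toℕs-· (actGen r g) w) (cong (_·ℕ map toℕ w) (toℕs-actGen r g))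

·-++ : ∀ {n} (r : Word n) u v → r · (u ++ v) ≡ r · u · v
·-++ r []      v = refl
·-++ r (g ∷ u) v = ·-++ (actGen r g) u v

toℕs-tabulate : ∀ {K} k l (f : Fin k → Fin K) → (∀ i → toℕ (f i) ≡ l + toℕ i) → toℕs (tabulate f) ≡ asc k l
toℕs-tabulate zero    l f f≡ = refl
toℕs-tabulate (suc k) l f f≡ =
  cong₂ _∷_ (trans (f≡ F.zero) (+-identityʳ l)) (toℕs-tabulate k (suc l) (f ∘ F.suc) (λ i → trans (f≡ (F.suc i)) (+-suc l (toℕ i))))

toℕs-one : ∀ n → toℕs (one n) ≡ asc n 1
toℕs-one n = toℕs-tabulate n 1 F.suc (λ _ → refl)

All-toℕs : ∀ {K k} {P : ℕ → Set} (r : Vec (Fin K) k) → (∀ j → P (toℕ (lookup r j))) → All P (toℕs r)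
All-toℕs V.[]      _ = []
All-toℕs (x V.∷ r) p = p F.zero ∷ All-toℕs r (λ j → p (F.suc j))

Distinct-toℕs : ∀ {K k} (r : Vec (Fin (suc K)) k) →
  ((i j : Fin k) → lookup r i ≡ lookup r j → lookup r i ≡ F.zero ⊎ i ≡ j) → Distinct (toℕs r)
Distinct-toℕs V.[]      _    = []
Distinct-toℕs {k = suc k} (x V.∷ r) rook = All-toℕs r x-compatible ∷ Distinct-toℕs r r-rook
  where
  x-compatible : ∀ j → Compatible (toℕ x) (toℕ (lookup r j))
  x-compatible j eq with rook F.zero (F.suc j) (toℕ-injective eq)
  ... | inj₁ x≡0 = cong toℕ x≡0
  r-rook : (i j : Fin k) → lookup r i ≡ lookup r j → lookup r i ≡ F.zero ⊎ i ≡ j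
  r-rook i j eq with rook (F.suc i) (F.suc j) eq
  ... | inj₁ ri≡0 = inj₁ ri≡0
  ... | inj₂ refl = inj₂ refl

IsRookList-toℕs : ∀ {n} (r : Rook n) → IsRookList n (toℕs (proj₁ r))
IsRookList-toℕs (r , rook) = isRookList (length-toList (V.map toℕ r))
  (All-toℕs r (λ j → toℕ≤pred[n] (lookup r j))) (Distinct-toℕs r rook)

canonicalWord : ∀ n → Word n → GWord n
canonicalWord zero    _ = []
canonicalWord (suc m) r = map (clamp m) (normalForm (suc m) (toℕs r))

canonicalWord-correct : ∀ n (r : Rook n) → one n · canonicalWord n (proj₁ r) ≡ proj₁ r
canonicalWord-correct zero    (V.[] , _) = refl
canonicalWord-correct (suc m) (r , rook) = toℕs-injective _ r (begin
    toℕs (one (suc m) · w)                    ≡⟨ toℕs-· (one (suc m)) w ⟩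
    toℕs (one (suc m)) ·ℕ map toℕ w           ≡⟨ cong₂ _·ℕ_ (toℕs-one (suc m)) (map-toℕ-clamp (normalForm (suc m) s) nf<n) ⟩
    asc (suc m) 1 ·ℕ normalForm (suc m) s     ≡⟨ normalForm-correct (suc m) s rk ⟩
    s                                         ∎)
  where
  open ≡-Reasoning
  s = toℕs r
  w = canonicalWord (suc m) r
  rk = IsRookList-toℕs (r , rook)
  nf<n = normalForm-< (suc m) s rk
  map-toℕ-clamp : ∀ v → All (_< suc m) v → map toℕ (map (clamp m) v) ≡ v
  map-toℕ-clamp []      []          = refl
  map-toℕ-clamp (k ∷ v) (s≤s k≤m ∷ v<) = cong₂ _∷_ (toℕ-clamp m k≤m) (map-toℕ-clamp v v<)

≈-canonicalWord : ∀ n (w : GWord n) → w ≈ canonicalWord n (one n · w)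
≈-canonicalWord zero    []  = ≈-refl
≈-canonicalWord (suc m) w = subst (_≈ canonicalWord (suc m) (one (suc m) · w)) (map-clamp-toℕ w) absorbed
  where
  open WordCongruence m
  open NormalFormLaw m using (normalForm-absorbs)
  v = map toℕ w
  absorbed : v ≈ℕ normalForm (suc m) (toℕs (one (suc m) · w))
  absorbed = begin
    v                                              ≡⟨ cong (_++ v) (normalForm-asc (suc m)) ⟨
    normalForm (suc m) (asc (suc m) 1) ++ v        ≈⟨ normalForm-absorbs (suc m) ≤-refl (asc (suc m) 1) (IsRookList-asc (suc m))
                                                                         v (map⁺ (All.universal toℕ<n w)) ⟩
    normalForm (suc m) (asc (suc m) 1 ·ℕ v)        ≡⟨ cong (λ t → normalForm (suc m) (t ·ℕ v)) (toℕs-one (suc m)) ⟨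
    normalForm (suc m) (toℕs (one (suc m)) ·ℕ v)   ≡⟨ cong (normalForm (suc m)) (toℕs-· (one (suc m)) w) ⟨
    normalForm (suc m) (toℕs (one (suc m) · w))    ∎
  map-clamp-toℕ : ∀ (u : GWord (suc m)) → map (clamp m) (map toℕ u) ≡ u
  map-clamp-toℕ []      = refl
  map-clamp-toℕ (i ∷ u) = cong₂ _∷_ (clamp-toℕ m i) (map-clamp-toℕ u)

words-unique : ∀ n (w w′ : GWord n) → one n · w ≡ one n · w′ → w ≈ w′
words-unique n w w′ eq =
  ≈-trans (≈-canonicalWord n w) (subst (λ r → canonicalWord n r ≈ w′) (sym eq) (≈-sym (≈-canonicalWord n w′)))

corollary3p49 : (n : ℕ) →
    ((r : Rook n) →
       Σ (GWord n) (λ w → one n · w ≡ proj₁ r)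
       × ((w w' : GWord n) → one n · w ≡ proj₁ r → one n · w' ≡ proj₁ r → w ≈ w'))
    × ((r s : Rook n) (wr ws wt : GWord n) →
       one n · wr ≡ proj₁ r → one n · ws ≡ proj₁ s →
       one n · wt ≡ proj₁ r · ws →
       (wr ++ ws) ≈ wt)
corollary3p49 n =
    (λ r → (canonicalWord n (proj₁ r) , canonicalWord-correct n r)
         , λ w w′ w-r w′-r → words-unique n w w′ (trans w-r (sym w′-r)))
  , λ r s wr ws wt wr-r _ wt-rs →
      words-unique n (wr ++ ws) wt (trans (·-++ (one n) wr ws) (trans (cong (_· ws) wr-r) (sym wt-rs)))
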